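{- In an adaptive Fibonacci heap (as defined in the context) containing $n$ nodes, obtained by any sequence of operations, the maximum degree of any node is $O(\lg n)$.
   Context: An adaptive Fibonacci heap $H$ storing $H.n$ elements with totally ordered keys is a collection of heap-ordered rooted trees (every node's key is at least its parent's key); comparisons $x<y$ between nodes compare keys. Each node $x$ stores a key, a parent pointer $x.parent$ (NIL for roots), a circular doubly linked list of its children, $x.degree$ = its number of children, and a boolean mark. The roots form a circular doubly linked root list; $H.min$ points to a root of minimum key. All lists are iterated from the oldest-added element to the newest-added one. "Linking $y$ as a child of $x$" means removing $y$ from its current list, making it a child of $x$, incrementing $x.degree$, and unmarking $y$. INSERT, FIND-MIN, UNION and DECREASE-KEY are exactly those of the Fibonacci heap (Cormen–Leiserson–Rivest–Stein, Ch. 19): INSERT adds a new unmarked root of degree 0; UNION concatenates root lists; DECREASE-KEY$(x,k)$ lowers the key of $x$ and, if now $x<x.parent=y$, cuts $x$ (moves it, unmarked, to the root list, decrementing $y.degree$) and then performs a cascading cut on $y$: if $y$ is not a root, then if $y$ is unmarked it is marked, and if it is marked it is cut and the cascading cut recurses on its parent. EXTRACT-MIN$(H)$: remove $z=H.min$ from the root list, move every child of $z$ to the root list with parent NIL; if the root list becomes empty set $H.min=$ NIL, otherwise call CONSOLIDATE$(H)$; decrement $H.n$; return $z$. CONSOLIDATE$(H)$: allocate an array $A[0\dots D(H.n)]$ with all entries NIL (where $D(n)$ is an upper bound on the maximum degree); for each node $x$ of the root list (in list order) call APPEND$(x, x.degree, A)$; then create a new empty root list and, for each non-NIL entry $x$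 of $A$ with $x.parent=$ NIL, insert $x$ into the root list, updating $H.min$ if $x<H.min$. APPEND$(x,d,A)$: let $y=A[d]$. If $y=$ NIL, nothing else is done before the final step. Else if $y<x$: if $y.degree=d$, link $x$ as a child of $y$; then, if $y.parent=$ NIL, call APPEND$(y, y.degree, A)$. Else (i.e. $y\ge x$), if $y.parent=$ NIL, link $y$ as a child of $x$. Finally, in all cases, set $A[d]=x$. -}

module Defs where

open import Level using (0ℓ)
open import Data.Nat using (ℕ; zero; suc; _+_; _∸_)
import Data.Nat as ℕ
open import Data.Bool using (Bool; true; false; if_then_else_)
open import Data.Maybe using (Maybe; just; nothing)
open import Data.Product using (_×_; _,_; proj₁; proj₂)
open import Data.List using (List; []; _∷_; _++_; [_]; length; filter; upTo)
open import Data.List.Membership.Propositional using (_∈_)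
open import Relation.Nullary using (¬_; yes; no)
open import Relation.Nullary.Decidable using (⌊_⌋; ¬?)
open import Relation.Binary.PropositionalEquality using (_≡_; _≢_)
open import Relation.Binary.Bundles using (StrictTotalOrder)

-- Node handles (memory addresses).  All heaps live in one shared memory.
Id : Set
Id = ℕ

module FibHeap (O : StrictTotalOrder 0ℓ 0ℓ 0ℓ) where
  open StrictTotalOrder O using (_<?_) renaming (Carrier to Key; _<_ to _<ₖ_)

  record Node : Set where
    constructor mkNode
    field
      key      : Key
      parent   : Maybe Id       -- nothing = NIL
      children : List Id        -- oldest-added child first
      mark     : Bool
  open Node public

  degree : Node → ℕ
  degree v = length (children v)

  Store : Set
  Store = Id → Node

  update : Store → Id → (Node → Node) → Store
  update s x f y with y ℕ.≟ x
  ... | yes _ = f (s y)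
  ... | no  _ = s y

  removeId : Id → List Id → List Id
  removeId x = filter (λ y → ¬? (y ℕ.≟ x))

  detach : Store → Id → Store
  detach s y with parent (s y)
  ... | nothing = s
  ... | just p  = update s p (λ v → record v { children = removeId y (children v) })

  -- link y as a child of x  (root-list bookkeeping is done by the caller)
  link : Store → Id → Id → Store
  link s y x =
    update (update (detach s y) x (λ v → record v { children = children v ++ [ y ] }))
           y (λ v → record v { parent = just x ; mark = false })

  -- cut x from its parent y (moving x to the root list is done by the caller)
  cut : Store → Id → Id → Store
  cut s x y =
    update (update s y (λ v → record v { children = removeId x (children v) }))
           x (λ v → record v { parent = nothing ; mark = false })

  newMin : Store → Maybe Id → Id → Maybe Id
  newMin s nothing  x = just x
  newMin s (just m) x = if ⌊ key (s x) <? key (s m) ⌋ then just x else just m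

  record Heap : Set where
    constructor mkHeap
    field
      roots : List Id         -- root list, oldest-added first
      min   : Maybe Id
      size  : ℕ
  open Heap public

  emptyHeap : Heap
  emptyHeap = mkHeap [] nothing 0

  -- a world: shared memory, allocation counter, and heaps 0,1,2,...
  -- (MAKE-HEAP = starting to use a fresh empty heap index)
  record World : Set where
    constructor mkWorld
    field
      store : Store
      next  : ℕ
      heaps : ℕ → Heap
  open World public

  setHeap : (ℕ → Heap) → ℕ → Heap → (ℕ → Heap)
  setHeap hs i h j with j ℕ.≟ i
  ... | yes _ = h
  ... | no  _ = hs j

  data InHeap (W : World) (i : ℕ) : Id → Set where
    in-root  : ∀ {x} → x ∈ roots (heaps W i) → InHeap W i x
    in-child : ∀ {x y} → InHeap W i y → x ∈ children (store W y) → InHeap W i x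

  insertW : World → ℕ → Key → World
  insertW (mkWorld s nx hs) i k =
    mkWorld s' (suc nx)
      (setHeap hs i (mkHeap (roots (hs i) ++ [ nx ]) (newMin s' (min (hs i)) nx) (suc (size (hs i)))))
    where
    s' : Store
    s' = update s nx (λ _ → mkNode k nothing [] false)

  -- UNION (heap i := UNION(H_i, H_j); heap j is consumed and becomes empty)
  unionMin : Store → Maybe Id → Maybe Id → Maybe Id
  unionMin s nothing  m2       = m2
  unionMin s (just a) nothing  = just a
  unionMin s (just a) (just b) = if ⌊ key (s b) <? key (s a) ⌋ then just b else just a

  unionW : World → ℕ → ℕ → World
  unionW (mkWorld s nx hs) i j =
    mkWorld s nx
      (setHeap (setHeap hs i (mkHeap (roots (hs i) ++ roots (hs j))
                                     (unionMin s (min (hs i)) (min (hs j)))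
                                     (size (hs i) + size (hs j))))
               j emptyHeap)

  setKey : Store → Id → Key → Store
  setKey s x k = update s x (λ v → record v { key = k })

  data CascCut : Store → List Id → Id → Store → List Id → Set where
    casc-root : ∀ {s R y} → parent (s y) ≡ nothing → CascCut s R y s R
    casc-mark : ∀ {s R y z} → parent (s y) ≡ just z → mark (s y) ≡ false →
                CascCut s R y (update s y (λ v → record v { mark = true })) R
    casc-cut  : ∀ {s R y z s' R'} → parent (s y) ≡ just z → mark (s y) ≡ true →
                CascCut (cut s y z) (R ++ [ y ]) z s' R' →
                CascCut s R y s' R'

  -- DECREASE-KEY(x,k) on a heap h in memory s (precondition k ≤ x.key is
  -- imposed in Reachable)
  data DecKey : Store → Heap → Id → Key → Store → Heap → Set where
    dk-root  : ∀ {s h x k} → parent (setKey s x k x) ≡ nothing →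
               DecKey s h x k (setKey s x k)
                      (mkHeap (roots h) (newMin (setKey s x k) (min h) x) (size h))
    dk-ok    : ∀ {s h x k y} → parent (setKey s x k x) ≡ just y →
               ¬ (k <ₖ key (setKey s x k y)) →
               DecKey s h x k (setKey s x k)
                      (mkHeap (roots h) (newMin (setKey s x k) (min h) x) (size h))
    dk-cut   : ∀ {s h x k y s' R'} → parent (setKey s x k x) ≡ just y →
               k <ₖ key (setKey s x k y) →
               CascCut (cut (setKey s x k) x y) (roots h ++ [ x ]) y s' R' →
               DecKey s h x k s' (mkHeap R' (newMin s' (min h) x) (size h))

  Arr : Set
  Arr = ℕ → Maybe Id

  emptyArr : Arr
  emptyArr _ = nothing

  setA : Arr → ℕ → Id → Arr
  setA A d x e with e ℕ.≟ d
  ... | yes _ = just x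
  ... | no  _ = A e

  linkIfDeg : Store → Id → Id → ℕ → Store
  linkIfDeg s x y d = if ⌊ degree (s y) ℕ.≟ d ⌋ then link s x y else s

  linkIfRoot : Store → Id → Id → Store
  linkIfRoot s y x with parent (s y)
  ... | nothing = link s y x
  ... | just _  = s

  data Append : Store → Arr → Id → ℕ → Store → Arr → Set
  data AppendIfRoot : Store → Arr → Id → Store → Arr → Set

  data Append where
    ap-nil  : ∀ {s A x d} → A d ≡ nothing → Append s A x d s (setA A d x)
    ap-less : ∀ {s A x d y s' A'} → A d ≡ just y → key (s y) <ₖ key (s x) →
              AppendIfRoot (linkIfDeg s x y d) A y s' A' →
              Append s A x d s' (setA A' d x)
    ap-geq  : ∀ {s A x d y} → A d ≡ just y → ¬ (key (s y) <ₖ key (s x)) →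
              Append s A x d (linkIfRoot s y x) (setA A d x)

  data AppendIfRoot where
    air-root : ∀ {s A y s' A'} → parent (s y) ≡ nothing →
               Append s A y (degree (s y)) s' A' → AppendIfRoot s A y s' A'
    air-skip : ∀ {s A y z} → parent (s y) ≡ just z → AppendIfRoot s A y s A

  data AppendAll : Store → Arr → List Id → Store → Arr → Set where
    aa-nil  : ∀ {s A} → AppendAll s A [] s A
    aa-cons : ∀ {s A x xs s₁ A₁ s₂ A₂} →
              Append s A x (degree (s x)) s₁ A₁ → AppendAll s₁ A₁ xs s₂ A₂ →
              AppendAll s A (x ∷ xs) s₂ A₂

  collect : Store → Arr → List ℕ → List Id → Maybe Id → List Id × Maybe Id
  collect s A []       R m = R , m
  collect s A (d ∷ ds) R m with A d
  ... | nothing = collect s A ds R m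
  ... | just x with parent (s x)
  ...   | just _  = collect s A ds R m
  ...   | nothing = collect s A ds (R ++ [ x ]) (newMin s m x)

  -- CONSOLIDATE on root list R with H.n = n; array A[0 .. n] (D(n) := n)
  data Consolidate : Store → List Id → ℕ → Store → List Id → Maybe Id → Set where
    consolidate : ∀ {s R n s₁ A₁} → AppendAll s emptyArr R s₁ A₁ →
                  Consolidate s R n s₁ (proj₁ (collect s₁ A₁ (upTo (suc n)) [] nothing))
                                       (proj₂ (collect s₁ A₁ (upTo (suc n)) [] nothing))

  clearParents : Store → List Id → Store
  clearParents s []       = s
  clearParents s (c ∷ cs) = clearParents (update s c (λ v → record v { parent = nothing })) cs

  data ExtractMin : Store → Heap → Store → Heap → Set where
    em-none  : ∀ {s h} → min h ≡ nothing → ExtractMin s h s h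
    em-empty : ∀ {s h z} → min h ≡ just z →
               removeId z (roots h) ++ children (s z) ≡ [] →
               ExtractMin s h (clearParents s (children (s z))) (mkHeap [] nothing (size h ∸ 1))
    em-cons  : ∀ {s h z s' R m} → min h ≡ just z →
               removeId z (roots h) ++ children (s z) ≢ [] →
               Consolidate (clearParents s (children (s z)))
                           (removeId z (roots h) ++ children (s z)) (size h) s' R m →
               ExtractMin s h s' (mkHeap R m (size h ∸ 1))

  data Reachable : World → Set where
    r-init     : (s : Store) → Reachable (mkWorld s 0 (λ _ → emptyHeap))
    r-insert   : ∀ {W} → Reachable W → (i : ℕ) (k : Key) → Reachable (insertW W i k)
    r-union    : ∀ {W i j} → Reachable W → i ≢ j → Reachable (unionW W i j)
    r-decrease : ∀ {W i x k s' h'} → Reachable W → InHeap W i x →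
                 ¬ (key (store W x) <ₖ k) →
                 DecKey (store W) (heaps W i) x k s' h' →
                 Reachable (mkWorld s' (next W) (setHeap (heaps W) i h'))
    r-extract  : ∀ {W i s' h'} → Reachable W →
                 ExtractMin (store W) (heaps W i) s' h' →
                 Reachable (mkWorld s' (next W) (setHeap (heaps W) i h'))

module Submission where

-- Each heap is shadowed by an abstract forest whose shape matches the parent and
-- child pointers of the store.  Every operation preserves the invariant that the
-- j-th child (counting from 0 in child-list order) of any node has degree + mark ≥ j.
-- APPEND links a root of degree d as the d-th child either of a root of degree d or
-- of a root whose degree is at least d; a node that loses one child becomes marked
-- and is cut when it loses a second.  So the j-th child has degree ≥ j ∸ 1, and a
-- node of degree k roots a subtree of at least minSize k nodes, where minSize grows
-- like the Fibonacci numbers, minSize k ≥ 2 ^ ⌊ k /2⌋.  Hence k ≤ 3 ⌊log₂ n⌋ once n ≥ 2.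

open import Defs
open import Level using (0ℓ)
open import Data.Nat using (ℕ; zero; suc; _+_; _∸_; _*_; _^_; _≤_; _<_; z≤n; s≤s; _≤?_; ⌊_/2⌋)
open import Data.Nat.Logarithm using (⌊log₂_⌋; ⌊log₂⌋-mono-≤; ⌊log₂[2^n]⌋≡n)
import Data.Nat as ℕ
open import Data.Nat.Properties
open import Data.Nat.Tactic.RingSolver using (solve-∀)
open import Data.Bool using (true; false; if_then_else_)
open import Data.Maybe using (Maybe; just; nothing)
open import Data.Maybe.Properties using (just-injective)
open import Data.Product using (Σ; ∃; _×_; _,_; proj₁; proj₂)
open import Data.Sum using (_⊎_; inj₁; inj₂; [_,_]′)
open import Data.Unit using (⊤; tt)
open import Data.Empty using (⊥; ⊥-elim)
open import Data.List using (List; []; _∷_; _++_; [_]; length; map; upTo)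
open import Data.List.Properties using (map-++; length-++; length-map; ++-identityʳ; ++-assoc; filter-++; filter-accept; filter-reject; ++-conicalʳ)
open import Data.List.Membership.Propositional using (_∈_)
open import Data.List.Membership.Propositional.Properties using (∈-++⁻; ∈-++⁺ˡ; ∈-++⁺ʳ; ∈-map⁺)
open import Data.List.Relation.Unary.Any using (here; there)
open import Data.List.Relation.Unary.All as All using (All; []; _∷_)
open import Data.List.Relation.Unary.Unique.Propositional using (Unique)
open import Data.List.Relation.Unary.Unique.Propositional.Properties using (upTo⁺)
import Data.List.Relation.Unary.AllPairs as AllPairs
open import Relation.Nullary using (¬_; yes; no; Dec)
open import Relation.Nullary.Decidable using (⌊_⌋; ¬?)
open import Relation.Binary.PropositionalEquality hiding ([_])
open import Relation.Binary.Bundles using (StrictTotalOrder)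
open import Relation.Binary.Definitions using (tri<; tri≈; tri>)
open import Function using (_∘_)

-- Fibonacci-like size bound

minSize : ℕ → ℕ
minSize 0 = 1
minSize 1 = 2
minSize (suc (suc n)) = minSize (suc n) + minSize n

minSize-suc : ∀ n → minSize n ≤ minSize (suc n)
minSize-suc 0 = s≤s z≤n
minSize-suc 1 = s≤s (s≤s z≤n)
minSize-suc (suc (suc n)) = m≤m+n _ _

minSize-mono : ∀ {m n} → m ≤ n → minSize m ≤ minSize n
minSize-mono {m} m≤n with m≤n⇒∃[o]m+o≡n m≤n
... | o , refl = go o
  where
  go : ∀ o → minSize m ≤ minSize (m + o)
  go zero rewrite +-identityʳ m = ≤-refl
  go (suc o) rewrite +-suc m o = ≤-trans (go o) (minSize-suc (m + o))

-- The least total size of the children from index j to j + n − 1, the i-th of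
-- which has degree at least i ∸ 1.
minSizeSiblings : ℕ → ℕ → ℕ
minSizeSiblings j 0 = 0
minSizeSiblings j (suc n) = minSize (j ∸ 1) + minSizeSiblings (suc j) n

minSizeSiblings-snoc : ∀ j n → minSizeSiblings j (suc n) ≡ minSizeSiblings j n + minSize ((j + n) ∸ 1)
minSizeSiblings-snoc j zero rewrite +-identityʳ j = +-comm (minSize (j ∸ 1)) 0
minSizeSiblings-snoc j (suc n) rewrite minSizeSiblings-snoc (suc j) n | +-suc j n =
  sym (+-assoc (minSize (j ∸ 1)) (minSizeSiblings (suc j) n) _)

minSize≤1+siblings : ∀ k → minSize k ≤ suc (minSizeSiblings 0 k)
minSize≤1+siblings 0 = ≤-refl
minSize≤1+siblings 1 = ≤-refl
minSize≤1+siblings (suc (suc k)) =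
  subst (λ m → minSize (suc (suc k)) ≤ suc m) (sym (minSizeSiblings-snoc 0 (suc k)))
    (+-monoˡ-≤ (minSize k) (minSize≤1+siblings (suc k)))

2^⌊n/2⌋≤minSize : ∀ n → 2 ^ ⌊ n /2⌋ ≤ minSize n
2^⌊n/2⌋≤minSize 0 = ≤-refl
2^⌊n/2⌋≤minSize 1 = s≤s z≤n
2^⌊n/2⌋≤minSize (suc (suc n)) =
  +-mono-≤ (≤-trans (2^⌊n/2⌋≤minSize n) (minSize-suc n)) (≤-trans (≤-reflexive (+-identityʳ _)) (2^⌊n/2⌋≤minSize n))

n≤1+2*⌊n/2⌋ : ∀ n → n ≤ suc (2 * ⌊ n /2⌋)
n≤1+2*⌊n/2⌋ 0 = z≤n
n≤1+2*⌊n/2⌋ 1 = s≤s z≤n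
n≤1+2*⌊n/2⌋ (suc (suc n)) = ≤-trans (s≤s (s≤s (n≤1+2*⌊n/2⌋ n))) (≤-reflexive (cong suc (lemma ⌊ n /2⌋)))
  where
  lemma : ∀ m → suc (suc (2 * m)) ≡ 2 * suc m
  lemma = solve-∀

minSize≤⇒≤3*log : ∀ k n → 2 ≤ n → minSize k ≤ n → k ≤ 3 * ⌊log₂ n ⌋
minSize≤⇒≤3*log k n 2≤n minSize≤n = begin
  k                      ≤⟨ n≤1+2*⌊n/2⌋ k ⟩
  suc (2 * ⌊ k /2⌋)      ≤⟨ s≤s (*-monoʳ-≤ 2 half≤log) ⟩
  1 + 2 * ⌊log₂ n ⌋      ≤⟨ +-monoˡ-≤ (2 * ⌊log₂ n ⌋) 1≤log ⟩
  3 * ⌊log₂ n ⌋          ∎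
  where
  open ≤-Reasoning
  half≤log : ⌊ k /2⌋ ≤ ⌊log₂ n ⌋
  half≤log = subst (_≤ ⌊log₂ n ⌋) (⌊log₂[2^n]⌋≡n ⌊ k /2⌋) (⌊log₂⌋-mono-≤ (≤-trans (2^⌊n/2⌋≤minSize k) minSize≤n))
  1≤log : 1 ≤ ⌊log₂ n ⌋
  1≤log = subst (_≤ ⌊log₂ n ⌋) (⌊log₂[2^n]⌋≡n 1) (⌊log₂⌋-mono-≤ 2≤n)

-- Forests, occurrences and zippers

data Tree : Set where
  node : Id → List Tree → Tree

label : Tree → Id
label (node x _) = x

subtrees : Tree → List Tree
subtrees (node _ ts) = ts

weightT : (Id → ℕ) → Tree → ℕ
weight : (Id → ℕ) → List Tree → ℕ
weightT f (node x ts) = f x + weight f ts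
weight f [] = 0
weight f (t ∷ ts) = weightT f t + weight f ts

weight-++ : ∀ f l r → weight f (l ++ r) ≡ weight f l + weight f r
weight-++ f [] r = refl
weight-++ f (t ∷ l) r rewrite weight-++ f l r = sym (+-assoc (weightT f t) (weight f l) (weight f r))

δ : Id → Id → ℕ
δ z x = if ⌊ z ℕ.≟ x ⌋ then 1 else 0

δ-≡ : ∀ z → δ z z ≡ 1
δ-≡ z with z ℕ.≟ z
... | yes _ = refl
... | no z≢z = ⊥-elim (z≢z refl)

δ-≢ : ∀ z x → z ≢ x → δ z x ≡ 0
δ-≢ z x z≢x with z ℕ.≟ x
... | yes z≡x = ⊥-elim (z≢x z≡x)
... | no _ = refl

-- occT z t is the number of occurrences of the label z in t; a forest is valid only
-- if every label occurs at most once, so 1 ≤ occ z F reads "z is a node of F".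
occT : Id → Tree → ℕ
occT z = weightT (δ z)

occ : Id → List Tree → ℕ
occ z = weight (δ z)

nodesT : Tree → ℕ
nodesT = weightT (λ _ → 1)

nodes : List Tree → ℕ
nodes = weight (λ _ → 1)

OccUnique : List Tree → Set
OccUnique F = ∀ z → occ z F ≤ 1

occ-++ : ∀ z l r → occ z (l ++ r) ≡ occ z l + occ z r
occ-++ z = weight-++ (δ z)

nodes-++ : ∀ l r → nodes (l ++ r) ≡ nodes l + nodes r
nodes-++ = weight-++ (λ _ → 1)

1≤+ˡ : ∀ {a} b → 1 ≤ a → 1 ≤ a + b
1≤+ˡ b p = ≤-trans p (m≤m+n _ b)

1≤+ʳ : ∀ a {b} → 1 ≤ b → 1 ≤ a + b
1≤+ʳ a p = ≤-trans p (m≤n+m _ a)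

1≤+⁻ : ∀ a b → 1 ≤ a + b → (1 ≤ a) ⊎ (1 ≤ b)
1≤+⁻ zero b p = inj₂ p
1≤+⁻ (suc a) b p = inj₁ (s≤s z≤n)

occ-label : ∀ t → 1 ≤ occT (label t) t
occ-label (node x ts) rewrite δ-≡ x = s≤s z≤n

∈labels⇒occ : ∀ x ts → x ∈ map label ts → 1 ≤ occ x ts
∈labels⇒occ x (t ∷ ts) (here refl) = 1≤+ˡ (occ (label t) ts) (occ-label t)
∈labels⇒occ x (t ∷ ts) (there p) = 1≤+ʳ (occT x t) (∈labels⇒occ x ts p)

occ-[]⁻ : ∀ {z F} → F ≡ [] → 1 ≤ occ z F → ⊥
occ-[]⁻ refl ()

occ-++⁺ˡ : ∀ z l r → 1 ≤ occ z l → 1 ≤ occ z (l ++ r)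
occ-++⁺ˡ z l r p = subst (1 ≤_) (sym (occ-++ z l r)) (1≤+ˡ (occ z r) p)

occ-++⁺ʳ : ∀ z l r → 1 ≤ occ z r → 1 ≤ occ z (l ++ r)
occ-++⁺ʳ z l r p = subst (1 ≤_) (sym (occ-++ z l r)) (1≤+ʳ (occ z l) p)

occ-++⁻ : ∀ z l r → 1 ≤ occ z (l ++ r) → (1 ≤ occ z l) ⊎ (1 ≤ occ z r)
occ-++⁻ z l r p = 1≤+⁻ (occ z l) (occ z r) (subst (1 ≤_) (occ-++ z l r) p)

-- A one-hole context in a forest: top l r is the root list with the hole between l
-- and r; down l r x Z is the child list of x, itself at the hole of Z.
data Zipper : Set where
  top  : List Tree → List Tree → Zipper
  down : List Tree → List Tree → Id → Zipper → Zipper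

plug : Zipper → Tree → List Tree
plug (top l r) t = l ++ t ∷ r
plug (down l r x Z) t = plug Z (node x (l ++ t ∷ r))

weightZ : (Id → ℕ) → Zipper → ℕ
weightZ f (top l r) = weight f l + weight f r
weightZ f (down l r x Z) = f x + (weight f l + weight f r) + weightZ f Z

weight-plug : ∀ f Z t → weight f (plug Z t) ≡ weightZ f Z + weightT f t
weight-plug f (top l r) t rewrite weight-++ f l (t ∷ r) = lemma (weight f l) (weightT f t) (weight f r)
  where
  lemma : ∀ a b c → a + (b + c) ≡ a + c + b
  lemma = solve-∀
weight-plug f (down l r x Z) t rewrite weight-plug f Z (node x (l ++ t ∷ r)) | weight-++ f l (t ∷ r) =
  lemma (f x) (weight f l) (weight f r) (weightZ f Z) (weightT f t)
  where
  lemma : ∀ a b c d e → d + (a + (b + (e + c))) ≡ a + (b + c) + d + e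
  lemma = solve-∀

occZ : Id → Zipper → ℕ
occZ z = weightZ (δ z)

nodesZ : Zipper → ℕ
nodesZ = weightZ (λ _ → 1)

occ-plug : ∀ z Z t → occ z (plug Z t) ≡ occZ z Z + occT z t
occ-plug z = weight-plug (δ z)

nodes-plug : ∀ Z t → nodes (plug Z t) ≡ nodesZ Z + nodesT t
nodes-plug = weight-plug (λ _ → 1)

occ-plug⁺ : ∀ w Z t → 1 ≤ occT w t → 1 ≤ occ w (plug Z t)
occ-plug⁺ w Z t p = subst (1 ≤_) (sym (occ-plug w Z t)) (1≤+ʳ (occZ w Z) p)

occ-plug-++ : ∀ w Z t E → 1 ≤ occT w t → 1 ≤ occ w (plug Z t ++ E)
occ-plug-++ w Z t E p = occ-++⁺ˡ w (plug Z t) E (occ-plug⁺ w Z t p)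

consZ : Tree → Zipper → Zipper
consZ u (top l r) = top (u ∷ l) r
consZ u (down l r x Z) = down l r x (consZ u Z)

plug-consZ : ∀ u Z t → plug (consZ u Z) t ≡ u ∷ plug Z t
plug-consZ u (top l r) t = refl
plug-consZ u (down l r x Z) t = plug-consZ u Z _

_⊕[_]_ : Zipper → Id → Zipper → Zipper
top l r ⊕[ x ] Zo = down l r x Zo
down l r y Z ⊕[ x ] Zo = down l r y (Z ⊕[ x ] Zo)

plug-⊕ : ∀ Z x Zo t → plug (Z ⊕[ x ] Zo) t ≡ plug Zo (node x (plug Z t))
plug-⊕ (top l r) x Zo t = refl
plug-⊕ (down l r y Z) x Zo t = plug-⊕ Z x Zo _

Location : Id → List Tree → Set
Location z F = Σ Zipper λ Z → Σ (List Tree) λ ts → F ≡ plug Z (node z ts)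

locate : ∀ z F → 1 ≤ occ z F → Location z F
locate z (node x us ∷ F) p with z ℕ.≟ x | 1 ≤? occ z us
... | yes refl | _ = top [] F , us , refl
... | no _ | yes q with locate z us q
...   | Z , ts , eq = Z ⊕[ x ] top [] F , ts , trans (cong (λ w → node x w ∷ F) eq) (sym (plug-⊕ Z x (top [] F) (node z ts)))
locate z (node x us ∷ F) p | no _ | no q with 1≤+⁻ (occ z us) (occ z F) p
... | inj₁ q′ = ⊥-elim (q q′)
... | inj₂ p′ with locate z F p′
...   | Z , ts , eq = consZ (node x us) Z , ts , trans (cong (node x us ∷_) eq) (sym (plug-consZ (node x us) Z (node z ts)))

occ-mid : ∀ w pre t post → occ w (pre ++ t ∷ post) ≡ occ w (pre ++ post) + occT w t
occ-mid w pre t post = trans (occ-plug w (top pre post) t) (cong (_+ occT w t) (sym (occ-++ w pre post)))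

+suc+≤1⇒≡0 : ∀ a b c → a + suc b + c ≤ 1 → (a ≡ 0) × (b ≡ 0) × (c ≡ 0)
+suc+≤1⇒≡0 zero zero zero _ = refl , refl , refl
+suc+≤1⇒≡0 zero zero (suc c) (s≤s ())
+suc+≤1⇒≡0 zero (suc b) c (s≤s ())
+suc+≤1⇒≡0 (suc a) b c (s≤s p) rewrite +-suc a b with p
... | ()

OccUnique-hole : ∀ Z y us E → OccUnique (plug Z (node y us) ++ E) → (occZ y Z ≡ 0) × (occ y us ≡ 0) × (occ y E ≡ 0)
OccUnique-hole Z y us E uq = +suc+≤1⇒≡0 (occZ y Z) (occ y us) (occ y E) (subst (_≤ 1) count (uq y))
  where
  count : occ y (plug Z (node y us) ++ E) ≡ occZ y Z + suc (occ y us) + occ y E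
  count rewrite occ-++ y (plug Z (node y us)) E | occ-plug y Z (node y us) | δ-≡ y = refl

OccUnique-hole′ : ∀ Z y us → OccUnique (plug Z (node y us)) → (occZ y Z ≡ 0) × (occ y us ≡ 0)
OccUnique-hole′ Z y us uq with OccUnique-hole Z y us [] (λ w → subst (λ G → occ w G ≤ 1) (sym (++-identityʳ (plug Z (node y us)))) (uq w))
... | a , b , _ = a , b

+≤1 : ∀ {a b} → a ≤ 1 → b ≤ 1 → (1 ≤ a → 1 ≤ b → ⊥) → a + b ≤ 1
+≤1 {zero} _ b≤1 _ = b≤1
+≤1 {suc a} {zero} a≤1 _ _ = subst (_≤ 1) (sym (+-identityʳ (suc a))) a≤1
+≤1 {suc a} {suc b} _ _ both = ⊥-elim (both (s≤s z≤n) (s≤s z≤n))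

OccUnique-++ : ∀ l r → OccUnique l → OccUnique r → (∀ z → 1 ≤ occ z l → 1 ≤ occ z r → ⊥) → OccUnique (l ++ r)
OccUnique-++ l r ul ur disj z = subst (_≤ 1) (sym (occ-++ z l r)) (+≤1 (ul z) (ur z) (disj z))

occ≡0⇒≢ : ∀ {y w} (o : Id → ℕ) → o y ≡ 0 → 1 ≤ o w → w ≢ y
occ≡0⇒≢ o e p refl with subst (1 ≤_) e p
... | ()

δ≡0⇒≢ : ∀ y x → δ y x ≡ 0 → y ≢ x
δ≡0⇒≢ y .y e refl with subst (1 ≤_) e (≤-reflexive (sym (δ-≡ y)))
... | ()

length-mid : ∀ {A : Set} (l r : List A) y → length (l ++ y ∷ r) ≡ suc (length (l ++ r))
length-mid l r y = trans (length-++ l) (trans (+-suc (length l) (length r)) (cong suc (sym (length-++ l))))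

just≢nothing : ∀ {A : Set} {a : A} → just a ≢ nothing
just≢nothing ()


labels-plug : ∀ Z t t' → label t ≡ label t' → map label (plug Z t) ≡ map label (plug Z t')
labels-plug (top l r) t t' e rewrite map-++ label l (t ∷ r) | map-++ label l (t' ∷ r) | e = refl
labels-plug (down l r x Z) t t' e = labels-plug Z _ _ refl

-- Cutting t out of the children of z moves it to the end of the root list.
weight-cut : ∀ f Z z l t r E → weight f (plug Z (node z (l ++ r)) ++ (E ++ [ t ])) ≡ weight f (plug Z (node z (l ++ t ∷ r)) ++ E)
weight-cut f Z z l t r E
  rewrite weight-++ f (plug Z (node z (l ++ r))) (E ++ [ t ]) | weight-++ f (plug Z (node z (l ++ t ∷ r))) E
        | weight-plug f Z (node z (l ++ r)) | weight-plug f Z (node z (l ++ t ∷ r))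
        | weight-++ f l r | weight-++ f l (t ∷ r) | weight-++ f E [ t ] =
  lemma (weightZ f Z) (f z) (weight f l) (weight f r) (weight f E) (weightT f t)
  where
  lemma : ∀ a b c d e g → a + (b + (c + d)) + (e + (g + 0)) ≡ a + (b + (c + (g + d))) + e
  lemma = solve-∀

labels-cut : ∀ Z z l t r E → map label (plug Z (node z (l ++ r)) ++ (E ++ [ t ])) ≡ map label (plug Z (node z (l ++ t ∷ r)) ++ E) ++ [ label t ]
labels-cut Z z l t r E = begin
  map label (plug Z (node z (l ++ r)) ++ (E ++ [ t ]))            ≡⟨ map-++ label (plug Z (node z (l ++ r))) (E ++ [ t ]) ⟩
  map label (plug Z (node z (l ++ r))) ++ map label (E ++ [ t ])  ≡⟨ cong₂ _++_ (labels-plug Z _ _ refl) (map-++ label E [ t ]) ⟩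
  map label G₀ ++ (map label E ++ [ label t ])                      ≡⟨ sym (++-assoc (map label G₀) (map label E) [ label t ]) ⟩
  (map label G₀ ++ map label E) ++ [ label t ]                      ≡⟨ cong (_++ [ label t ]) (sym (map-++ label G₀ E)) ⟩
  map label (G₀ ++ E) ++ [ label t ]                                ∎
  where
  open ≡-Reasoning
  G₀ = plug Z (node z (l ++ t ∷ r))

weight-link : ∀ f pre t post Zp p ps → pre ++ post ≡ plug Zp (node p ps) →
  weight f (plug Zp (node p (ps ++ [ t ]))) ≡ weight f (pre ++ t ∷ post)
weight-link f pre t post Zp p ps at = begin
  weight f (plug Zp (node p (ps ++ [ t ])))                   ≡⟨ weight-plug f Zp _ ⟩
  weightZ f Zp + (f p + weight f (ps ++ [ t ]))               ≡⟨ cong (λ u → weightZ f Zp + (f p + u)) (weight-++ f ps [ t ]) ⟩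
  weightZ f Zp + (f p + (weight f ps + (weightT f t + 0)))    ≡⟨ lemma₁ (weightZ f Zp) (f p) (weight f ps) (weightT f t) ⟩
  weightZ f Zp + (f p + weight f ps) + weightT f t            ≡⟨ cong (_+ weightT f t) (sym (trans (cong (weight f) at) (weight-plug f Zp (node p ps)))) ⟩
  weight f (pre ++ post) + weightT f t                        ≡⟨ cong (_+ weightT f t) (weight-++ f pre post) ⟩
  weight f pre + weight f post + weightT f t                  ≡⟨ lemma₂ (weight f pre) (weight f post) (weightT f t) ⟩
  weight f pre + (weightT f t + weight f post)                ≡⟨ sym (weight-++ f pre (t ∷ post)) ⟩
  weight f (pre ++ t ∷ post)                                  ∎
  where
  open ≡-Reasoning
  lemma₁ : ∀ a b c d → a + (b + (c + (d + 0))) ≡ a + (b + c) + d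
  lemma₁ = solve-∀
  lemma₂ : ∀ a b c → a + b + c ≡ a + (c + b)
  lemma₂ = solve-∀

weight-move : ∀ f F pre t post → weight f (F ++ [ t ]) + weight f (pre ++ post) ≡ weight f F + weight f (pre ++ t ∷ post)
weight-move f F pre t post
  rewrite weight-++ f F [ t ] | weight-++ f pre post | weight-++ f pre (t ∷ post) =
  lemma (weight f F) (weightT f t) (weight f pre) (weight f post)
  where
  lemma : ∀ a b c d → a + (b + 0) + (c + d) ≡ a + (c + (b + d))
  lemma = solve-∀

split-labels : ∀ x G → x ∈ map label G → Σ (List Tree) λ pre → Σ Tree λ t → Σ (List Tree) λ post → (G ≡ pre ++ t ∷ post) × (label t ≡ x)
split-labels x (t ∷ G) (here refl) = [] , t , G , refl , refl
split-labels x (u ∷ G) (there p) with split-labels x G p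
... | pre , t , post , refl , e = u ∷ pre , t , post , refl , e

∈labels-remove : ∀ y pre t post → y ∈ map label (pre ++ t ∷ post) → y ≢ label t → y ∈ map label (pre ++ post)
∈labels-remove y pre t post p y≢t rewrite map-++ label pre (t ∷ post) | map-++ label pre post with ∈-++⁻ (map label pre) p
... | inj₁ q = ∈-++⁺ˡ q
... | inj₂ (here e) = ⊥-elim (y≢t e)
... | inj₂ (there q) = ∈-++⁺ʳ (map label pre) q

+≤1-exclusive : ∀ {a b} → 1 ≤ a → 1 ≤ b → a + b ≤ 1 → ⊥
+≤1-exclusive p q h with ≤-trans (+-mono-≤ p q) h
... | s≤s ()

occLabels : Id → List Tree → ℕ
occLabels w [] = 0
occLabels w (t ∷ ts) = δ w (label t) + occLabels w ts

occBelow : Id → List Tree → ℕ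
occBelow w [] = 0
occBelow w (node x cs ∷ ts) = occ w cs + occBelow w ts

occ-split : ∀ w ts → occ w ts ≡ occLabels w ts + occBelow w ts
occ-split w [] = refl
occ-split w (node x cs ∷ ts) rewrite occ-split w ts = lemma (δ w x) (occ w cs) (occLabels w ts) (occBelow w ts)
  where
  lemma : ∀ a b c d → a + b + (c + d) ≡ a + c + (b + d)
  lemma = solve-∀

occLabels-∈ : ∀ w ts → w ∈ map label ts → 1 ≤ occLabels w ts
occLabels-∈ w (t ∷ ts) (here refl) = 1≤+ˡ (occLabels (label t) ts) (≤-reflexive (sym (δ-≡ (label t))))
occLabels-∈ w (t ∷ ts) (there p) = 1≤+ʳ (δ w (label t)) (occLabels-∈ w ts p)

occBelow-∈ : ∀ w x cs ts → node x cs ∈ ts → 1 ≤ occ w cs → 1 ≤ occBelow w ts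
occBelow-∈ w x cs (node .x .cs ∷ ts) (here refl) p = 1≤+ˡ (occBelow w ts) p
occBelow-∈ w x cs (node y ys ∷ ts) (there q) p = 1≤+ʳ (occ w ys) (occBelow-∈ w x cs ts q p)

OccUnique⇒Unique : ∀ G → OccUnique G → Unique (map label G)
OccUnique⇒Unique [] _ = AllPairs.[]
OccUnique⇒Unique (t ∷ G) u =
  All.tabulate (λ {y} q e → +≤1-exclusive (occ-label t) (∈labels⇒occ (label t) G (subst (_∈ map label G) (sym e) q)) (u (label t)))
  AllPairs.∷ OccUnique⇒Unique G (λ w → m+n≤o⇒n≤o (occT w t) (u w))

weight-extract : ∀ f pre z us post → weight f (pre ++ node z us ∷ post) ≡ f z + weight f ((pre ++ post) ++ us)
weight-extract f pre z us post
  rewrite weight-++ f pre (node z us ∷ post) | weight-++ f (pre ++ post) us | weight-++ f pre post =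
  lemma (weight f pre) (f z) (weight f us) (weight f post)
  where
  lemma : ∀ a b c d → a + (b + c + d) ≡ b + (a + d + c)
  lemma = solve-∀

-- Well-formed forests

module _ (O : StrictTotalOrder 0ℓ 0ℓ 0ℓ) where
  open FibHeap O
  open StrictTotalOrder O using (compare; irrefl; <-resp-≈; asym)
    renaming (Carrier to Key; _<?_ to _<ₖ?_; _<_ to _<ₖ_; trans to <ₖ-trans)
  open StrictTotalOrder.Eq O using () renaming (refl to ≈-refl)

  _≤ₖ_ : Key → Key → Set
  a ≤ₖ b = ¬ (b <ₖ a)

  ≤ₖ-refl : ∀ {a} → a ≤ₖ a
  ≤ₖ-refl = irrefl ≈-refl

  ≤ₖ-trans : ∀ {a b c} → a ≤ₖ b → b ≤ₖ c → a ≤ₖ c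
  ≤ₖ-trans {a} {b} {c} a≤b b≤c c<a with compare a b
  ... | tri< a<b _ _ = b≤c (<ₖ-trans c<a a<b)
  ... | tri≈ _ a≈b _ = b≤c (proj₁ <-resp-≈ a≈b c<a)
  ... | tri> _ _ b<a = a≤b b<a

  ≡⇒≤ₖ : ∀ {a b} → a ≡ b → a ≤ₖ b
  ≡⇒≤ₖ refl = ≤ₖ-refl

  <⇒≤ₖ : ∀ {a b} → a <ₖ b → a ≤ₖ b
  <⇒≤ₖ a<b b<a = asym a<b b<a

  <-≤ₖ-trans : ∀ {a b c} → a <ₖ b → b ≤ₖ c → a <ₖ c
  <-≤ₖ-trans {a} {b} {c} a<b b≤c with compare a c
  ... | tri< a<c _ _ = a<c
  ... | tri≈ _ a≈c _ = ⊥-elim (b≤c (proj₂ <-resp-≈ a≈c a<b))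
  ... | tri> _ _ c<a = ⊥-elim (b≤c (<ₖ-trans c<a a<b))

  update-≡ : ∀ s x f → update s x f x ≡ f (s x)
  update-≡ s x f with x ℕ.≟ x
  ... | yes _ = refl
  ... | no x≢x = ⊥-elim (x≢x refl)

  update-≢ : ∀ s x f y → y ≢ x → update s x f y ≡ s y
  update-≢ s x f y y≢x with y ℕ.≟ x
  ... | yes y≡x = ⊥-elim (y≢x y≡x)
  ... | no _ = refl

  markBit : Node → ℕ
  markBit v = if mark v then 1 else 0

  markBit≤1 : ∀ v → markBit v ≤ 1
  markBit≤1 v with mark v
  ... | true = ≤-refl
  ... | false = z≤n

  ChildAt : Id → Key → ℕ → Node → Set
  ChildAt x kx j v = (parent v ≡ just x) × (kx ≤ₖ key v) × (j ≤ degree v + markBit v)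

  WfTree : Store → Tree → Set
  WfChildren : Store → Id → ℕ → List Tree → Set
  WfTree s (node x ts) = (map label ts ≡ children (s x)) × WfChildren s x 0 ts
  WfChildren s x j [] = ⊤
  WfChildren s x j (t ∷ ts) = ChildAt x (key (s x)) j (s (label t)) × WfTree s t × WfChildren s x (suc j) ts

  WfForest : Store → List Tree → Set
  WfForest s [] = ⊤
  WfForest s (t ∷ ts) = (parent (s (label t)) ≡ nothing) × WfTree s t × WfForest s ts

  WfForest-++ : ∀ s l r → WfForest s l → WfForest s r → WfForest s (l ++ r)
  WfForest-++ s [] r _ q = q
  WfForest-++ s (t ∷ l) r (a , b , c) q = a , b , WfForest-++ s l r c q

  WfForest-++⁻ˡ : ∀ s l r → WfForest s (l ++ r) → WfForest s l
  WfForest-++⁻ˡ s [] r _ = tt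
  WfForest-++⁻ˡ s (t ∷ l) r (a , b , c) = a , b , WfForest-++⁻ˡ s l r c

  WfForest-++⁻ʳ : ∀ s l r → WfForest s (l ++ r) → WfForest s r
  WfForest-++⁻ʳ s [] r p = p
  WfForest-++⁻ʳ s (t ∷ l) r (a , b , c) = WfForest-++⁻ʳ s l r c

  WfForest-mid : ∀ s pre t post → WfForest s (pre ++ t ∷ post) →
                 (parent (s (label t)) ≡ nothing) × WfTree s t × WfForest s (pre ++ post)
  WfForest-mid s pre t post w with WfForest-++⁻ʳ s pre (t ∷ post) w
  ... | a , b , c = a , b , WfForest-++ s pre post (WfForest-++⁻ˡ s pre _ w) c

  WfForest-root : ∀ s G w → WfForest s G → w ∈ map label G → parent (s w) ≡ nothing
  WfForest-root s (t ∷ G) w (a , _ , _) (here refl) = a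
  WfForest-root s (t ∷ G) w (_ , _ , c) (there p) = WfForest-root s G w c p

  WfChildren-++ : ∀ s x j l r → WfChildren s x j l → WfChildren s x (j + length l) r → WfChildren s x j (l ++ r)
  WfChildren-++ s x j [] r _ q rewrite +-identityʳ j = q
  WfChildren-++ s x j (t ∷ l) r (a , b , c) q =
    a , b , WfChildren-++ s x (suc j) l r c (subst (λ k → WfChildren s x k r) (+-suc j (length l)) q)

  WfChildren-++⁻ˡ : ∀ s x j l r → WfChildren s x j (l ++ r) → WfChildren s x j l
  WfChildren-++⁻ˡ s x j [] r _ = tt
  WfChildren-++⁻ˡ s x j (t ∷ l) r (a , b , c) = a , b , WfChildren-++⁻ˡ s x (suc j) l r c

  WfChildren-++⁻ʳ : ∀ s x j l r → WfChildren s x j (l ++ r) → WfChildren s x (j + length l) r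
  WfChildren-++⁻ʳ s x j [] r p rewrite +-identityʳ j = p
  WfChildren-++⁻ʳ s x j (t ∷ l) r (a , b , c) =
    subst (λ k → WfChildren s x k r) (sym (+-suc j (length l))) (WfChildren-++⁻ʳ s x (suc j) l r c)

  WfChildren-lower : ∀ s x j k ts → k ≤ j → WfChildren s x j ts → WfChildren s x k ts
  WfChildren-lower s x j k [] le p = tt
  WfChildren-lower s x j k (t ∷ ts) le ((a , b , c) , d , e) =
    (a , b , ≤-trans le c) , d , WfChildren-lower s x (suc j) (suc k) ts (s≤s le) e

  WfChildren-∈ : ∀ s x j ts t → t ∈ ts → WfChildren s x j ts → WfTree s t
  WfChildren-∈ s x j (t ∷ ts) .t (here refl) (_ , w , _) = w
  WfChildren-∈ s x j (u ∷ ts) t (there q) (_ , _ , w) = WfChildren-∈ s x (suc j) ts t q w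

  degree≡length : ∀ (s : Store) x ts → map label ts ≡ children (s x) → degree (s x) ≡ length ts
  degree≡length s x ts ch = trans (cong length (sym ch)) (length-map label ts)

  minSize≤nodesT : ∀ s t → WfTree s t → minSize (length (subtrees t)) ≤ nodesT t
  minSizeSiblings≤nodes : ∀ s x j ts → WfChildren s x j ts → minSizeSiblings j (length ts) ≤ nodes ts
  minSize≤nodesT s (node x ts) (_ , wf) = ≤-trans (minSize≤1+siblings (length ts)) (s≤s (minSizeSiblings≤nodes s x 0 ts wf))
  minSizeSiblings≤nodes s x j [] _ = z≤n
  minSizeSiblings≤nodes s x j (node y us ∷ ts) ((_ , _ , j≤deg+mark) , wt , wf) =
    +-mono-≤ (≤-trans (minSize-mono j-1≤deg) (minSize≤nodesT s (node y us) wt)) (minSizeSiblings≤nodes s x (suc j) ts wf)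
    where
    j-1≤deg : j ∸ 1 ≤ length us
    j-1≤deg = ≤-trans (∸-monoˡ-≤ 1 (≤-trans j≤deg+mark (+-monoʳ-≤ (degree (s y)) (markBit≤1 (s y)))))
                (≤-reflexive (trans (m+n∸n≡m (degree (s y)) 1) (degree≡length s y us (proj₁ wt))))

  WfHole : Store → Zipper → Node → Set
  WfHole s (top l r) v = parent v ≡ nothing
  WfHole s (down l r x Z) v = ChildAt x (key (s x)) (length l) v

  -- The hole condition of a node that has just lost a child and is waiting for the
  -- cascading cut to mark it or to cut it.
  WfHoleLoose : Store → Zipper → Node → Set
  WfHoleLoose s (top l r) v = parent v ≡ nothing
  WfHoleLoose s (down l r x Z) v = (parent v ≡ just x) × (key (s x) ≤ₖ key v) × (length l ≤ suc (degree v + markBit v))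

  WfZipper : Store → Zipper → Id → Set
  WfZipper s (top l r) h = WfForest s l × WfForest s r
  WfZipper s (down l r x Z) h =
    (map label l ++ h ∷ map label r ≡ children (s x)) × WfChildren s x 0 l × WfChildren s x (suc (length l)) r ×
    WfZipper s Z x × WfHole s Z (s x)

  WfForest-plug⁻ : ∀ s Z t → WfForest s (plug Z t) → WfZipper s Z (label t) × WfHole s Z (s (label t)) × WfTree s t
  WfForest-plug⁻ s (top l r) t p with WfForest-++⁻ʳ s l (t ∷ r) p
  ... | a , b , c = (WfForest-++⁻ˡ s l (t ∷ r) p , c) , a , b
  WfForest-plug⁻ s (down l r x Z) t p with WfForest-plug⁻ s Z (node x (l ++ t ∷ r)) p
  ... | wz , hz , (ch , wf) with WfChildren-++⁻ʳ s x 0 l (t ∷ r) wf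
  ... | (a , b , c) = (trans (sym (map-++ label l (t ∷ r))) ch , WfChildren-++⁻ˡ s x 0 l (t ∷ r) wf , c , wz , hz) , a , b

  WfForest-plug⁺ : ∀ s Z t → WfZipper s Z (label t) → WfHole s Z (s (label t)) → WfTree s t → WfForest s (plug Z t)
  WfForest-plug⁺ s (top l r) t (wl , wr) hz wt = WfForest-++ s l (t ∷ r) wl (hz , wt , wr)
  WfForest-plug⁺ s (down l r x Z) t (ch , wl , wr , wz , hz') hz wt =
    WfForest-plug⁺ s Z (node x (l ++ t ∷ r)) wz hz' (trans (map-++ label l (t ∷ r)) ch , WfChildren-++ s x 0 l (t ∷ r) wl (hz , wt , wr))

  WfHole-mono : ∀ s Z v v' → WfHole s Z v → parent v' ≡ parent v → key v ≤ₖ key v' →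
                degree v + markBit v ≤ degree v' + markBit v' → WfHole s Z v'
  WfHole-mono s (top l r) v v' h p k d = trans p h
  WfHole-mono s (down l r x Z) v v' (a , b , c) p k d = trans p a , ≤ₖ-trans b k , ≤-trans c d

  WfHole⇒WfHoleLoose : ∀ s Z v v' → WfHole s Z v → parent v' ≡ parent v → key v ≤ₖ key v' →
                       degree v + markBit v ≤ suc (degree v' + markBit v') → WfHoleLoose s Z v'
  WfHole⇒WfHoleLoose s (top l r) v v' h p k d = trans p h
  WfHole⇒WfHoleLoose s (down l r x Z) v v' (a , b , c) p k d = trans p a , ≤ₖ-trans b k , ≤-trans c d

  heapOrderT : ∀ s c cs w → WfTree s (node c cs) → 1 ≤ occ w cs → (parent (s w) ≢ nothing) × (key (s c) ≤ₖ key (s w))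
  heapOrder : ∀ s c j cs w → WfChildren s c j cs → 1 ≤ occ w cs → (parent (s w) ≢ nothing) × (key (s c) ≤ₖ key (s w))
  heapOrderT s c cs w (_ , wf) p = heapOrder s c 0 cs w wf p
  heapOrder s c j (node y ys ∷ cs) w ((y↑c , c≤y , _) , wt , wf) p with 1≤+⁻ (occT w (node y ys)) (occ w cs) p
  ... | inj₂ q = heapOrder s c (suc j) cs w wf q
  ... | inj₁ q with w ℕ.≟ y
  ...   | yes refl = (λ e → just≢nothing (trans (sym y↑c) e)) , c≤y
  ...   | no _ with heapOrderT s y ys w wt q
  ...     | w↑ , y≤w = w↑ , ≤ₖ-trans c≤y y≤w

  heapOrderT-self : ∀ s x cs w → WfTree s (node x cs) → 1 ≤ occT w (node x cs) → key (s x) ≤ₖ key (s w)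
  heapOrderT-self s x cs w wt p with w ℕ.≟ x
  ... | yes refl = ≤ₖ-refl
  ... | no _ = proj₂ (heapOrderT s x cs w wt p)

  root-split : ∀ s G c → WfForest s G → 1 ≤ occ c G → parent (s c) ≡ nothing →
               Σ (List Tree) λ pre → Σ (List Tree) λ cs → Σ (List Tree) λ post → G ≡ pre ++ node c cs ∷ post
  root-split s G c w p pc with locate c G p
  ... | top l r , cs , eq = l , cs , r , eq
  ... | down l r x Z , cs , eq with WfForest-plug⁻ s (down l r x Z) (node c cs) (subst (WfForest s) eq w)
  ...   | _ , (c↑x , _) , _ = ⊥-elim (just≢nothing (trans (sym c↑x) pc))

  root∈labels : ∀ s G c → WfForest s G → 1 ≤ occ c G → parent (s c) ≡ nothing → c ∈ map label G
  root∈labels s G c w p pc with root-split s G c w p pc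
  ... | pre , cs , post , refl = subst (c ∈_) (sym (map-++ label pre (node c cs ∷ post))) (∈-++⁺ʳ (map label pre) (here refl))

  AgreeOn : Store → Store → (Id → ℕ) → Set
  AgreeOn s s' o = ∀ z → 1 ≤ o z → s' z ≡ s z

  AgreeOn-++ˡ : ∀ {s s'} (a b : Id → ℕ) → AgreeOn s s' (λ z → a z + b z) → AgreeOn s s' a
  AgreeOn-++ˡ a b ag z p = ag z (1≤+ˡ (b z) p)

  AgreeOn-++ʳ : ∀ {s s'} (a b : Id → ℕ) → AgreeOn s s' (λ z → a z + b z) → AgreeOn s s' b
  AgreeOn-++ʳ a b ag z p = ag z (1≤+ʳ (a z) p)

  WfTree-agree-root : ∀ s s' x ts → WfTree s (node x ts) → AgreeOn s s' (λ z → occ z ts) →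
                      key (s' x) ≤ₖ key (s x) → children (s' x) ≡ children (s x) → WfTree s' (node x ts)
  WfChildren-agree : ∀ s s' x j ts → WfChildren s x j ts → AgreeOn s s' (λ z → occ z ts) →
                     key (s' x) ≤ₖ key (s x) → WfChildren s' x j ts
  WfTree-agree : ∀ s s' t → WfTree s t → AgreeOn s s' (λ z → occT z t) → WfTree s' t
  WfTree-agree-root s s' x ts (ch , wf) ag kx cx = trans ch (sym cx) , WfChildren-agree s s' x 0 ts wf ag kx
  WfChildren-agree s s' x j [] p ag kx = tt
  WfChildren-agree s s' x j (t ∷ ts) ((a , b , c) , d , e) ag kx =
    subst (ChildAt x (key (s' x)) j) (sym (ag (label t) (1≤+ˡ (occ (label t) ts) (occ-label t)))) (a , ≤ₖ-trans kx b , c) ,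
    WfTree-agree s s' t d (AgreeOn-++ˡ (λ z → occT z t) (λ z → occ z ts) ag) ,
    WfChildren-agree s s' x (suc j) ts e (AgreeOn-++ʳ (λ z → occT z t) (λ z → occ z ts) ag) kx
  WfTree-agree s s' (node x ts) w ag =
    WfTree-agree-root s s' x ts w (AgreeOn-++ʳ (λ z → δ z x) (λ z → occ z ts) ag)
      (≡⇒≤ₖ (cong key x-agrees)) (cong children x-agrees)
    where
    x-agrees : s' x ≡ s x
    x-agrees = ag x (occ-label (node x ts))

  WfForest-agree : ∀ s s' F → WfForest s F → AgreeOn s s' (λ z → occ z F) → WfForest s' F
  WfForest-agree s s' [] _ _ = tt
  WfForest-agree s s' (t ∷ F) (a , b , c) ag =
    trans (cong parent (ag (label t) (1≤+ˡ (occ (label t) F) (occ-label t)))) a ,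
    WfTree-agree s s' t b (AgreeOn-++ˡ (λ z → occT z t) (λ z → occ z F) ag) ,
    WfForest-agree s s' F c (AgreeOn-++ʳ (λ z → occT z t) (λ z → occ z F) ag)

  WfHole-agree : ∀ s s' Z v → WfHole s Z v → AgreeOn s s' (λ z → occZ z Z) → WfHole s' Z v
  WfHole-agree s s' (top l r) v h ag = h
  WfHole-agree s s' (down l r x Z) v (a , b , c) ag =
    a , subst (λ k → k ≤ₖ key v) (sym (cong key (ag x (1≤+ˡ (occZ x Z) (1≤+ˡ (occ x l + occ x r) (≤-reflexive (sym (δ-≡ x)))))))) b , c

  WfZipper-agree : ∀ s s' Z h → WfZipper s Z h → AgreeOn s s' (λ z → occZ z Z) → WfZipper s' Z h
  WfZipper-agree s s' (top l r) h (a , b) ag =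
    WfForest-agree s s' l a (AgreeOn-++ˡ (λ z → occ z l) (λ z → occ z r) ag) ,
    WfForest-agree s s' r b (AgreeOn-++ʳ (λ z → occ z l) (λ z → occ z r) ag)
  WfZipper-agree s s' (down l r x Z) h (ch , wl , wr , wz , hz) ag =
    trans ch (sym (cong children x-agrees)) ,
    WfChildren-agree s s' x 0 l wl (AgreeOn-++ˡ (λ z → occ z l) (λ z → occ z r) on-lr) (≡⇒≤ₖ (cong key x-agrees)) ,
    WfChildren-agree s s' x _ r wr (AgreeOn-++ʳ (λ z → occ z l) (λ z → occ z r) on-lr) (≡⇒≤ₖ (cong key x-agrees)) ,
    WfZipper-agree s s' Z x wz on-Z ,
    subst (WfHole s' Z) (sym x-agrees) (WfHole-agree s s' Z (s x) hz on-Z)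
    where
    on-x+lr : AgreeOn s s' (λ z → δ z x + (occ z l + occ z r))
    on-x+lr = AgreeOn-++ˡ (λ z → δ z x + (occ z l + occ z r)) (λ z → occZ z Z) ag
    on-lr : AgreeOn s s' (λ z → occ z l + occ z r)
    on-lr = AgreeOn-++ʳ (λ z → δ z x) (λ z → occ z l + occ z r) on-x+lr
    on-Z : AgreeOn s s' (λ z → occZ z Z)
    on-Z = AgreeOn-++ʳ (λ z → δ z x + (occ z l + occ z r)) (λ z → occZ z Z) ag
    x-agrees : s' x ≡ s x
    x-agrees = on-x+lr x (1≤+ˡ (occ x l + occ x r) (≤-reflexive (sym (δ-≡ x))))

  -- The invariant

  IsMinRoot : Store → List Tree → Id → Set
  IsMinRoot s F m = (parent (s m) ≡ nothing) × (1 ≤ occ m F) × (∀ z → 1 ≤ occ z F → key (s m) ≤ₖ key (s z))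

  MinCorrect : Store → List Tree → Maybe Id → Set
  MinCorrect s F mn = (mn ≡ nothing → F ≡ []) × (∀ m → mn ≡ just m → IsMinRoot s F m)

  record Invariant (W : World) : Set where
    field
      forest       : ℕ → List Tree
      forest-wf    : ∀ i → WfForest (store W) (forest i)
      roots≡labels : ∀ i → roots (heaps W i) ≡ map label (forest i)
      unique       : ∀ i → OccUnique (forest i)
      disjoint     : ∀ i j z → 1 ≤ occ z (forest i) → 1 ≤ occ z (forest j) → i ≡ j
      allocated    : ∀ i z → 1 ≤ occ z (forest i) → z < next W
      nodes≤size   : ∀ i → nodes (forest i) ≤ size (heaps W i)
      minCorrect   : ∀ i → MinCorrect (store W) (forest i) (min (heaps W i))

  module _ {W : World} (I : Invariant W) where
    open Invariant I

    InHeap⇒occ : ∀ i x → InHeap W i x → 1 ≤ occ x (forest i)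
    InHeap⇒occ i x (in-root p) = ∈labels⇒occ x (forest i) (subst (x ∈_) (roots≡labels i) p)
    InHeap⇒occ i x (in-child {y = y} h p) with locate y (forest i) (InHeap⇒occ i y h)
    ... | Z , ts , eq with WfForest-plug⁻ (store W) Z (node y ts) (subst (WfForest (store W)) eq (forest-wf i))
    ...   | _ , _ , (ch , _) = subst (λ F → 1 ≤ occ x F) (sym eq)
            (occ-plug⁺ x Z (node y ts) (1≤+ʳ (δ x y) (∈labels⇒occ x ts (subst (x ∈_) (sym ch) p))))

    minSize-degree≤size : ∀ i x → InHeap W i x → minSize (degree (store W x)) ≤ size (heaps W i)
    minSize-degree≤size i x h with locate x (forest i) (InHeap⇒occ i x h)
    ... | Z , ts , eq = begin
      minSize (degree (store W x))   ≡⟨ cong minSize (degree≡length (store W) x ts (proj₁ wt)) ⟩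
      minSize (length ts)            ≤⟨ minSize≤nodesT (store W) (node x ts) wt ⟩
      nodesT (node x ts)             ≤⟨ m≤n+m _ (nodesZ Z) ⟩
      nodesZ Z + nodesT (node x ts)  ≡⟨ sym (trans (cong nodes eq) (nodes-plug Z (node x ts))) ⟩
      nodes (forest i)               ≤⟨ nodes≤size i ⟩
      size (heaps W i)               ∎
      where
      open ≤-Reasoning
      wt : WfTree (store W) (node x ts)
      wt = proj₂ (proj₂ (WfForest-plug⁻ (store W) Z (node x ts) (subst (WfForest (store W)) eq (forest-wf i))))

    occ-next≡0 : ∀ j → occ (next W) (forest j) ≡ 0
    occ-next≡0 j with occ (next W) (forest j) | allocated j (next W)
    ... | zero | _ = refl
    ... | suc _ | h = ⊥-elim (<-irrefl refl (h (s≤s z≤n)))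

  setForest : (ℕ → List Tree) → ℕ → List Tree → ℕ → List Tree
  setForest F i G j with j ℕ.≟ i
  ... | yes _ = G
  ... | no _ = F j

  MinCorrect-newMin : ∀ s F mn x → parent (s x) ≡ nothing → 1 ≤ occ x F →
    (mn ≡ nothing → ∀ z → 1 ≤ occ z F → key (s x) ≤ₖ key (s z)) →
    (∀ m → mn ≡ just m → (parent (s m) ≡ nothing) × (1 ≤ occ m F) ×
                         (∀ z → 1 ≤ occ z F → (key (s m) ≤ₖ key (s z)) ⊎ (key (s x) ≤ₖ key (s z)))) →
    MinCorrect s F (newMin s mn x)
  MinCorrect-newMin s F nothing x px xF x-min _ = (λ ()) , λ { _ refl → px , xF , x-min refl }
  MinCorrect-newMin s F (just m) x px xF _ m-or-x with key (s x) <ₖ? key (s m) | m-or-x m refl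
  ... | yes x<m | _ , _ , ≤m∨x = (λ ()) , λ { _ refl → px , xF , λ z p → [ ≤ₖ-trans (<⇒≤ₖ x<m) , (λ q → q) ]′ (≤m∨x z p) }
  ... | no x≮m | pm , mF , ≤m∨x = (λ ()) , λ { _ refl → pm , mF , λ z p → [ (λ q → q) , ≤ₖ-trans x≮m ]′ (≤m∨x z p) }

  occ-snoc⁻ : ∀ w F n → 1 ≤ occ w (F ++ [ node n [] ]) → (1 ≤ occ w F) ⊎ (w ≡ n)
  occ-snoc⁻ w F n p with occ-++⁻ w F _ p
  ... | inj₁ q = inj₁ q
  ... | inj₂ q with w ℕ.≟ n
  ...   | yes w≡n = inj₂ w≡n
  occ-snoc⁻ w F n p | inj₂ () | no _

  MinCorrect-snoc : ∀ s F mn n → MinCorrect s F mn → parent (s n) ≡ nothing → MinCorrect s (F ++ [ node n [] ]) (newMin s mn n)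
  MinCorrect-snoc s F mn n (empty , isMin) n-root =
    MinCorrect-newMin s (F ++ [ node n [] ]) mn n n-root (occ-++⁺ʳ n F _ (1≤+ˡ 0 (occ-label (node n [])))) n-min m-or-n
    where
    n-min : mn ≡ nothing → ∀ z → 1 ≤ occ z (F ++ [ node n [] ]) → key (s n) ≤ₖ key (s z)
    n-min e z p with occ-snoc⁻ z F n p
    ... | inj₁ q = ⊥-elim (occ-[]⁻ (empty e) q)
    ... | inj₂ refl = ≤ₖ-refl
    m-or-n : ∀ m → mn ≡ just m → (parent (s m) ≡ nothing) × (1 ≤ occ m (F ++ [ node n [] ])) ×
               (∀ z → 1 ≤ occ z (F ++ [ node n [] ]) → (key (s m) ≤ₖ key (s z)) ⊎ (key (s n) ≤ₖ key (s z)))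
    m-or-n m e with isMin m e
    ... | m-root , mF , m≤ = m-root , occ-++⁺ˡ m F _ mF ,
          λ z p → [ (λ q → inj₁ (m≤ z q)) , (λ { refl → inj₂ ≤ₖ-refl }) ]′ (occ-snoc⁻ z F n p)

  MinCorrect-agree : ∀ s s' F mn → MinCorrect s F mn → AgreeOn s s' (λ z → occ z F) → MinCorrect s' F mn
  MinCorrect-agree s s' F mn (empty , isMin) ag = empty , λ m eq → agree-min (isMin m eq)
    where
    agree-min : ∀ {m} → IsMinRoot s F m → IsMinRoot s' F m
    agree-min {m} (pm , mF , m≤) rewrite ag m mF = pm , mF , λ z zF → subst (λ v → key (s m) ≤ₖ key v) (sym (ag z zF)) (m≤ z zF)

  -- Insertion and union

  module _ {W : World} (I : Invariant W) where
    open Invariant I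

    replaceHeap-preserves : ∀ i s' n' h' G' → next W ≤ n' →
      WfForest s' G' → roots h' ≡ map label G' → OccUnique G' →
      (∀ w → 1 ≤ occ w G' → (1 ≤ occ w (forest i)) ⊎ ((next W ≤ w) × (w < n'))) →
      nodes G' ≤ size h' → MinCorrect s' G' (min h') →
      (∀ w → occ w (forest i) ≡ 0 → w < next W → s' w ≡ store W w) →
      Invariant (mkWorld s' n' (setHeap (heaps W) i h'))
    replaceHeap-preserves i s' n' h' G' next≤n' wfG rootsG uniqueG oldOrFresh nodesG minG agree = record
      { forest = F' ; forest-wf = wf' ; roots≡labels = roots' ; unique = unique' ; disjoint = disjoint'
      ; allocated = allocated' ; nodes≤size = nodes' ; minCorrect = min' }
      where
      s = store W
      F' = setForest forest i G'
      outside-i : ∀ j → j ≢ i → ∀ w → 1 ≤ occ w (forest j) → occ w (forest i) ≡ 0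
      outside-i j j≢i w p with occ w (forest i) in e
      ... | zero = refl
      ... | suc _ = ⊥-elim (j≢i (disjoint j i w p (subst (1 ≤_) (sym e) (s≤s z≤n))))
      agree-j : ∀ j → j ≢ i → AgreeOn s s' (λ w → occ w (forest j))
      agree-j j j≢i w p = agree w (outside-i j j≢i w p) (allocated j w p)
      old-or-fresh : ∀ j w → 1 ≤ occ w (F' j) → (1 ≤ occ w (forest j)) ⊎ ((j ≡ i) × (next W ≤ w) × (w < n'))
      old-or-fresh j w p with j ℕ.≟ i
      ... | no _ = inj₁ p
      ... | yes refl with oldOrFresh w p
      ...   | inj₁ q = inj₁ q
      ...   | inj₂ (n≤w , w<n') = inj₂ (refl , n≤w , w<n')
      wf' : ∀ j → WfForest s' (F' j)
      wf' j with j ℕ.≟ i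
      ... | yes refl = wfG
      ... | no j≢i = WfForest-agree s s' (forest j) (forest-wf j) (agree-j j j≢i)
      roots' : ∀ j → roots (setHeap (heaps W) i h' j) ≡ map label (F' j)
      roots' j with j ℕ.≟ i
      ... | yes refl = rootsG
      ... | no _ = roots≡labels j
      unique' : ∀ j → OccUnique (F' j)
      unique' j with j ℕ.≟ i
      ... | yes refl = uniqueG
      ... | no _ = unique j
      disjoint' : ∀ j j' w → 1 ≤ occ w (F' j) → 1 ≤ occ w (F' j') → j ≡ j'
      disjoint' j j' w p q with old-or-fresh j w p | old-or-fresh j' w q
      ... | inj₁ a | inj₁ b = disjoint j j' w a b
      ... | inj₁ a | inj₂ (_ , n≤w , _) = ⊥-elim (<⇒≱ (allocated j w a) n≤w)
      ... | inj₂ (_ , n≤w , _) | inj₁ b = ⊥-elim (<⇒≱ (allocated j' w b) n≤w)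
      ... | inj₂ (refl , _) | inj₂ (refl , _) = refl
      allocated' : ∀ j w → 1 ≤ occ w (F' j) → w < n'
      allocated' j w p with old-or-fresh j w p
      ... | inj₁ a = <-≤-trans (allocated j w a) next≤n'
      ... | inj₂ (_ , _ , w<n') = w<n'
      nodes' : ∀ j → nodes (F' j) ≤ size (setHeap (heaps W) i h' j)
      nodes' j with j ℕ.≟ i
      ... | yes refl = nodesG
      ... | no _ = nodes≤size j
      min' : ∀ j → MinCorrect s' (F' j) (min (setHeap (heaps W) i h' j))
      min' j with j ℕ.≟ i
      ... | yes refl = minG
      ... | no j≢i = MinCorrect-agree s s' (forest j) _ (minCorrect j) (agree-j j j≢i)

    shrinkHeap-preserves : ∀ i s' h' G' →
      WfForest s' G' → roots h' ≡ map label G' → (∀ w → occ w G' ≤ occ w (forest i)) →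
      nodes G' ≤ size h' → MinCorrect s' G' (min h') →
      (∀ w → occ w (forest i) ≡ 0 → s' w ≡ store W w) →
      Invariant (mkWorld s' (next W) (setHeap (heaps W) i h'))
    shrinkHeap-preserves i s' h' G' wfG rootsG occG nodesG minG agree =
      replaceHeap-preserves i s' (next W) h' G' ≤-refl wfG rootsG (λ w → ≤-trans (occG w) (unique i w))
        (λ w p → inj₁ (≤-trans p (occG w))) nodesG minG (λ w o _ → agree w o)

  insert-preserves : ∀ {W} → Invariant W → ∀ i k → Invariant (insertW W i k)
  insert-preserves {mkWorld s n hs} I i k =
    replaceHeap-preserves I i s' (suc n) _ G' (n≤1+n n) wfG rootsG uniqueG old-or-fresh
      (subst (_≤ suc (size (hs i))) (sym nodesG) (s≤s (nodes≤size i))) minG agree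
    where
    open Invariant I
    v = mkNode k nothing [] false
    s' = update s n (λ _ → v)
    G' = forest i ++ [ node n [] ]
    s'n : s' n ≡ v
    s'n = update-≡ s n (λ _ → v)
    agree : ∀ w → occ w (forest i) ≡ 0 → w < n → s' w ≡ s w
    agree w _ w<n = update-≢ s n (λ _ → v) w (λ w≡n → <-irrefl w≡n w<n)
    agree-i : AgreeOn s s' (λ w → occ w (forest i))
    agree-i w p = update-≢ s n (λ _ → v) w (λ w≡n → <-irrefl w≡n (allocated i w p))
    wfG : WfForest s' G'
    wfG = WfForest-++ s' (forest i) _ (WfForest-agree s s' (forest i) (forest-wf i) agree-i)
            (cong parent s'n , (cong children (sym s'n) , tt) , tt)
    rootsG : roots (hs i) ++ [ n ] ≡ map label G'
    rootsG = trans (cong (_++ [ n ]) (roots≡labels i)) (sym (map-++ label (forest i) [ node n [] ]))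
    old-or-fresh : ∀ w → 1 ≤ occ w G' → (1 ≤ occ w (forest i)) ⊎ ((n ≤ w) × (w < suc n))
    old-or-fresh w p with occ-snoc⁻ w (forest i) n p
    ... | inj₁ q = inj₁ q
    ... | inj₂ refl = inj₂ (≤-refl , ≤-refl)
    uniqueG : OccUnique G'
    uniqueG w rewrite occ-++ w (forest i) [ node n [] ] with w ℕ.≟ n
    ... | yes refl rewrite occ-next≡0 I i = ≤-refl
    ... | no _ rewrite +-identityʳ (occ w (forest i)) = unique i w
    nodesG : nodes G' ≡ suc (nodes (forest i))
    nodesG = trans (nodes-++ (forest i) [ node n [] ]) (+-comm (nodes (forest i)) 1)
    minG : MinCorrect s' G' (newMin s' (min (hs i)) n)
    minG = MinCorrect-snoc s' (forest i) (min (hs i)) n (MinCorrect-agree s s' (forest i) (min (hs i)) (minCorrect i) agree-i) (cong parent s'n)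

  unionMin-correct : ∀ s Fi Fj mi mj → MinCorrect s Fi mi → MinCorrect s Fj mj → MinCorrect s (Fi ++ Fj) (unionMin s mi mj)
  unionMin-correct s Fi Fj nothing mj (empty , _) minj rewrite empty refl = minj
  unionMin-correct s Fi Fj (just x) nothing mini (empty , _) rewrite empty refl | ++-identityʳ Fi = mini
  unionMin-correct s Fi Fj (just x) (just y) (_ , isMinᵢ) (_ , isMinⱼ) with key (s y) <ₖ? key (s x) | isMinᵢ x refl | isMinⱼ y refl
  ... | yes y<x | _ , _ , x≤ | py , yF , y≤ =
    (λ ()) , λ { _ refl → py , occ-++⁺ʳ y Fi Fj yF , λ z p → [ (λ q → ≤ₖ-trans (<⇒≤ₖ y<x) (x≤ z q)) , y≤ z ]′ (occ-++⁻ z Fi Fj p) }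
  ... | no y≮x | px , xF , x≤ | _ , _ , y≤ =
    (λ ()) , λ { _ refl → px , occ-++⁺ˡ x Fi Fj xF , λ z p → [ x≤ z , (λ q → ≤ₖ-trans y≮x (y≤ z q)) ]′ (occ-++⁻ z Fi Fj p) }

  union-preserves : ∀ {W i j} → Invariant W → i ≢ j → Invariant (unionW W i j)
  union-preserves {mkWorld s n hs} {i} {j} I i≢j = record
    { forest = F' ; forest-wf = wf' ; roots≡labels = roots' ; unique = unique' ; disjoint = disjoint'
    ; allocated = allocated' ; nodes≤size = nodes' ; minCorrect = min' }
    where
    open Invariant I
    hs' = heaps (unionW (mkWorld s n hs) i j)
    F' = setForest (setForest forest i (forest i ++ forest j)) j []
    origin : ∀ a z → 1 ≤ occ z (F' a) → Σ ℕ λ b → (1 ≤ occ z (forest b)) × (a ≢ j) × ((a ≡ b) ⊎ ((a ≡ i) × (b ≡ j)))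
    origin a z p with a ℕ.≟ j
    origin a z () | yes _
    ... | no a≢j with a ℕ.≟ i
    ...   | no _ = a , p , a≢j , inj₁ refl
    ...   | yes a≡i with occ-++⁻ z (forest i) (forest j) p
    ...     | inj₁ q = i , q , a≢j , inj₁ a≡i
    ...     | inj₂ q = j , q , a≢j , inj₂ (a≡i , refl)
    wf' : ∀ a → WfForest s (F' a)
    wf' a with a ℕ.≟ j
    ... | yes _ = tt
    ... | no _ with a ℕ.≟ i
    ...   | yes _ = WfForest-++ s (forest i) (forest j) (forest-wf i) (forest-wf j)
    ...   | no _ = forest-wf a
    roots' : ∀ a → roots (hs' a) ≡ map label (F' a)
    roots' a with a ℕ.≟ j
    ... | yes _ = refl
    ... | no _ with a ℕ.≟ i
    ...   | yes _ = trans (cong₂ _++_ (roots≡labels i) (roots≡labels j)) (sym (map-++ label (forest i) (forest j)))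
    ...   | no _ = roots≡labels a
    unique' : ∀ a → OccUnique (F' a)
    unique' a with a ℕ.≟ j
    ... | yes _ = λ _ → z≤n
    ... | no _ with a ℕ.≟ i
    ...   | yes _ = OccUnique-++ (forest i) (forest j) (unique i) (unique j) (λ z p q → i≢j (disjoint i j z p q))
    ...   | no _ = unique a
    disjoint' : ∀ a a' z → 1 ≤ occ z (F' a) → 1 ≤ occ z (F' a') → a ≡ a'
    disjoint' a a' z p q with origin a z p | origin a' z q
    ... | b , pb , a≢j , ca | b' , pb' , a'≢j , ca' with disjoint b b' z pb pb'
    ... | refl with ca | ca'
    ...   | inj₁ e | inj₁ e' = trans e (sym e')
    ...   | inj₁ refl | inj₂ (_ , refl) = ⊥-elim (a≢j refl)
    ...   | inj₂ (_ , refl) | inj₁ refl = ⊥-elim (a'≢j refl)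
    ...   | inj₂ (e , _) | inj₂ (e' , _) = trans e (sym e')
    allocated' : ∀ a z → 1 ≤ occ z (F' a) → z < n
    allocated' a z p with origin a z p
    ... | b , pb , _ = allocated b z pb
    nodes' : ∀ a → nodes (F' a) ≤ size (hs' a)
    nodes' a with a ℕ.≟ j
    ... | yes _ = z≤n
    ... | no _ with a ℕ.≟ i
    ...   | yes _ rewrite nodes-++ (forest i) (forest j) = +-mono-≤ (nodes≤size i) (nodes≤size j)
    ...   | no _ = nodes≤size a
    min' : ∀ a → MinCorrect s (F' a) (min (hs' a))
    min' a with a ℕ.≟ j
    ... | yes _ = (λ _ → refl) , λ _ ()
    ... | no _ with a ℕ.≟ i
    ...   | yes _ = unionMin-correct s (forest i) (forest j) _ _ (minCorrect i) (minCorrect j)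
    ...   | no _ = minCorrect a

  -- Cuts and decreasing keys

  key-update : ∀ s y (f : Node → Node) → (∀ v → key (f v) ≡ key v) → ∀ w → key (update s y f w) ≡ key (s w)
  key-update s y f keep w with w ℕ.≟ y
  ... | yes refl = keep (s w)
  ... | no _ = refl

  removeId-absent : ∀ y l → occ y l ≡ 0 → removeId y (map label l) ≡ map label l
  removeId-absent y [] e = refl
  removeId-absent y (node x us ∷ l) e =
    trans (filter-accept (λ w → ¬? (w ℕ.≟ y)) (λ x≡y → δ≡0⇒≢ y x (m+n≡0⇒m≡0 _ (m+n≡0⇒m≡0 _ e)) (sym x≡y)))
          (cong (x ∷_) (removeId-absent y l (m+n≡0⇒n≡0 (occT y (node x us)) e)))

  removeId-mid : ∀ y l r → occ y l ≡ 0 → occ y r ≡ 0 → removeId y (map label l ++ y ∷ map label r) ≡ map label l ++ map label r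
  removeId-mid y l r yl yr =
    trans (filter-++ (λ w → ¬? (w ℕ.≟ y)) (map label l) (y ∷ map label r))
      (cong₂ _++_ (removeId-absent y l yl) (trans (filter-reject (λ w → ¬? (w ℕ.≟ y)) (λ y≢y → y≢y refl)) (removeId-absent y r yr)))

  cut-child : ∀ s y z → y ≢ z → cut s y z y ≡ record (s y) { parent = nothing ; mark = false }
  cut-child s y z y≢z = trans (update-≡ _ y _) (cong (λ v → record v { parent = nothing ; mark = false }) (update-≢ s z _ y y≢z))

  cut-parent : ∀ s y z → y ≢ z → cut s y z z ≡ record (s z) { children = removeId y (children (s z)) }
  cut-parent s y z y≢z = trans (update-≢ _ y _ z (λ z≡y → y≢z (sym z≡y))) (update-≡ s z _)

  cut-other : ∀ s y z w → w ≢ y → w ≢ z → cut s y z w ≡ s w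
  cut-other s y z w w≢y w≢z = trans (update-≢ _ y _ w w≢y) (update-≢ s z _ w w≢z)

  cut-key : ∀ s y z w → key (cut s y z w) ≡ key (s w)
  cut-key s y z w = trans (key-update _ y _ (λ _ → refl) w) (key-update s z _ (λ _ → refl) w)

  cut-root : ∀ s y z w → parent (s w) ≡ nothing → parent (cut s y z w) ≡ nothing
  cut-root s y z w w-root with w ℕ.≟ y
  ... | yes refl = refl
  ... | no _ with w ℕ.≟ z
  ...   | yes refl = w-root
  ...   | no _ = w-root

  -- E are the roots added by the cuts so far; y may have just lost a child.
  CascadeState : Store → Zipper → Id → List Tree → List Tree → Set
  CascadeState s Z y us E =
    WfZipper s Z y × WfHoleLoose s Z (s y) × WfTree s (node y us) × WfForest s E × OccUnique (plug Z (node y us) ++ E)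

  cut-step : ∀ s y z l r Z us E → WfZipper s (down l r z Z) y → WfTree s (node y us) → WfForest s E →
    OccUnique (plug Z (node z (l ++ node y us ∷ r)) ++ E) →
    (y ≢ z) × CascadeState (cut s y z) Z z (l ++ r) (E ++ [ node y us ])
  cut-step s y z l r Z us E (ch , wl , wr , wz , hz) wt wE uq =
    y≢z , WfZipper-agree s s₁ Z z wz on-Z , loose , wt-z , wE-y , uq'
    where
    s₁ = cut s y z
    t = node y us
    split : ∀ a {b} → a + b ≡ 0 → (a ≡ 0) × (b ≡ 0)
    split a e = m+n≡0⇒m≡0 a e , m+n≡0⇒n≡0 a e
    y-absent = OccUnique-hole (down l r z Z) y us E uq
    z-absent = OccUnique-hole Z z (l ++ t ∷ r) E uq
    yz+lr = split (δ y z + (occ y l + occ y r)) (proj₁ y-absent)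
    yz = split (δ y z) (proj₁ yz+lr)
    zl+tr = split (occ z l) (trans (sym (occ-++ z l (t ∷ r))) (proj₁ (proj₂ z-absent)))
    zt+r = split (occT z t) (proj₂ zl+tr)
    y≢z : y ≢ z
    y≢z = δ≡0⇒≢ y z (proj₁ yz)
    agree : (o : Id → ℕ) → o y ≡ 0 → o z ≡ 0 → AgreeOn s s₁ o
    agree o oy oz w p = cut-other s y z w (occ≡0⇒≢ o oy p) (occ≡0⇒≢ o oz p)
    on-Z : AgreeOn s s₁ (λ w → occZ w Z)
    on-Z = agree (λ w → occZ w Z) (proj₂ yz+lr) (proj₁ z-absent)
    s₁z = cut-parent s y z y≢z
    children-z : children (s₁ z) ≡ map label l ++ map label r
    children-z = trans (cong children s₁z) (trans (cong (removeId y) (sym ch))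
                   (removeId-mid y l r (proj₁ (split (occ y l) (proj₂ yz))) (proj₂ (split (occ y l) (proj₂ yz)))))
    degree-z : degree (s z) ≡ suc (degree (s₁ z))
    degree-z = trans (cong length (sym ch)) (trans (length-mid (map label l) (map label r) y) (cong (suc ∘ length) (sym children-z)))
    loose : WfHoleLoose s₁ Z (s₁ z)
    loose = WfHole⇒WfHoleLoose s₁ Z (s z) (s₁ z) (WfHole-agree s s₁ Z (s z) hz on-Z) (cong parent s₁z)
              (≡⇒≤ₖ (sym (cong key s₁z))) (≤-reflexive (cong₂ _+_ degree-z (cong markBit (sym s₁z))))
    wt-z : WfTree s₁ (node z (l ++ r))
    wt-z = trans (map-++ label l r) (sym children-z) ,
           WfChildren-agree s s₁ z 0 (l ++ r) (WfChildren-++ s z 0 l r wl (WfChildren-lower s z (suc (length l)) (length l) r (n≤1+n _) wr))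
             (agree (λ w → occ w (l ++ r)) (trans (occ-++ y l r) (proj₂ yz)) (trans (occ-++ z l r) (cong₂ _+_ (proj₁ zl+tr) (proj₂ zt+r))))
             (≡⇒≤ₖ (cong key s₁z))
    wE-y : WfForest s₁ (E ++ [ t ])
    wE-y = WfForest-++ s₁ E [ t ] (WfForest-agree s s₁ E wE (agree (λ w → occ w E) (proj₂ (proj₂ y-absent)) (proj₂ (proj₂ z-absent))))
             (cong parent (cut-child s y z y≢z) ,
              WfTree-agree-root s s₁ y us wt (agree (λ w → occ w us) (proj₁ (proj₂ y-absent)) (m+n≡0⇒n≡0 (δ z y) (proj₁ zt+r)))
                (≡⇒≤ₖ (cong key (cut-child s y z y≢z))) (cong children (cut-child s y z y≢z)) ,
              tt)
    uq' : OccUnique (plug Z (node z (l ++ r)) ++ (E ++ [ t ]))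
    uq' w = subst (_≤ 1) (sym (weight-cut (δ w) Z z l t r E)) (uq w)

  agree-except : ∀ s y f (o : Id → ℕ) → o y ≡ 0 → AgreeOn s (update s y f) o
  agree-except s y f o oy w p = update-≢ s y f w (occ≡0⇒≢ o oy p)

  record CascadeResult (s : Store) (G : List Tree) (s' : Store) (R' : List Id) : Set where
    field
      result            : List Tree
      result-roots      : R' ≡ map label result
      result-wf         : WfForest s' result
      result-occ        : ∀ z → occ z result ≡ occ z G
      result-nodes      : nodes result ≡ nodes G
      result-agree      : ∀ z → occ z G ≡ 0 → s' z ≡ s z
      result-keys       : ∀ z → key (s' z) ≡ key (s z)
      result-roots-kept : ∀ z → parent (s z) ≡ nothing → parent (s' z) ≡ nothing

  cascade-preserves : ∀ {s R y s' R'} → CascCut s R y s' R' → ∀ Z us E → R ≡ map label (plug Z (node y us) ++ E) →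
    CascadeState s Z y us E → CascadeResult s (plug Z (node y us) ++ E) s' R'
  cut-cascade : ∀ {s R y z s' R'} → CascCut (cut s y z) (R ++ [ y ]) z s' R' → ∀ l r Z us E →
    R ≡ map label (plug Z (node z (l ++ node y us ∷ r)) ++ E) →
    WfZipper s (down l r z Z) y → WfTree s (node y us) → WfForest s E → OccUnique (plug Z (node z (l ++ node y us ∷ r)) ++ E) →
    CascadeResult s (plug Z (node z (l ++ node y us ∷ r)) ++ E) s' R'

  cascade-preserves {s} (casc-root y-root) (top l r) us E eR (wz , hole , wt , wE , _) = record
    { result = plug (top l r) (node _ us) ++ E ; result-roots = eR
    ; result-wf = WfForest-++ s _ E (WfForest-plug⁺ s (top l r) (node _ us) wz hole wt) wE
    ; result-occ = λ _ → refl ; result-nodes = refl ; result-agree = λ _ _ → refl ; result-keys = λ _ → refl ; result-roots-kept = λ _ q → q }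
  cascade-preserves (casc-root y-root) (down l r x Z) us E eR (_ , (y↑x , _) , _) = ⊥-elim (just≢nothing (trans (sym y↑x) y-root))
  cascade-preserves (casc-mark y↑ unmarked) (top l r) us E eR (_ , y-root , _) = ⊥-elim (just≢nothing (trans (sym y↑) y-root))
  cascade-preserves {s} {y = y} (casc-mark _ unmarked) (down l r x Z) us E eR (wz , (y↑x , x≤y , pos) , wt , wE , uq) = record
    { result = G ; result-roots = eR ; result-wf = WfForest-++ s' _ E (WfForest-plug⁺ s' (down l r x Z) (node y us) wz' hole' wt') wE'
    ; result-occ = λ _ → refl ; result-nodes = refl ; result-agree = agree-outside
    ; result-keys = key-update s y setMark (λ _ → refl) ; result-roots-kept = roots-kept }
    where
    setMark : Node → Node
    setMark v = record v { mark = true }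
    s' = update s y setMark
    G = plug (down l r x Z) (node y us) ++ E
    y-absent = OccUnique-hole (down l r x Z) y us E uq
    s'y : s' y ≡ setMark (s y)
    s'y = update-≡ s y setMark
    agree-outside : ∀ w → occ w G ≡ 0 → s' w ≡ s w
    agree-outside w e = update-≢ s y setMark w (≢-sym (occ≡0⇒≢ (λ u → occ u G) e (occ-plug-++ y (down l r x Z) (node y us) E (occ-label (node y us)))))
    wz' : WfZipper s' (down l r x Z) y
    wz' = WfZipper-agree s s' (down l r x Z) y wz (agree-except s y setMark (λ w → occZ w (down l r x Z)) (proj₁ y-absent))
    -- the lost child is paid for by the mark
    hole' : WfHole s' (down l r x Z) (s' y)
    hole' rewrite s'y | key-update s y setMark (λ _ → refl) x | unmarked =
      y↑x , x≤y , ≤-trans pos (≤-reflexive (trans (cong suc (+-identityʳ (degree (s y)))) (+-comm 1 (degree (s y)))))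
    wt' : WfTree s' (node y us)
    wt' = WfTree-agree-root s s' y us wt (agree-except s y setMark (λ w → occ w us) (proj₁ (proj₂ y-absent)))
            (≡⇒≤ₖ (cong key s'y)) (cong children s'y)
    wE' : WfForest s' E
    wE' = WfForest-agree s s' E wE (agree-except s y setMark (λ w → occ w E) (proj₂ (proj₂ y-absent)))
    roots-kept : ∀ w → parent (s w) ≡ nothing → parent (s' w) ≡ nothing
    roots-kept w w-root with w ℕ.≟ y
    ... | yes refl = ⊥-elim (just≢nothing (trans (sym y↑x) w-root))
    ... | no _ = w-root
  cascade-preserves (casc-cut y↑ _ _) (top l r) us E eR (_ , y-root , _) = ⊥-elim (just≢nothing (trans (sym y↑) y-root))
  cascade-preserves (casc-cut y↑ _ rest) (down l r x Z) us E eR (wz , (y↑x , _) , wt , wE , uq)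
    with just-injective (trans (sym y↑) y↑x)
  ... | refl = cut-cascade rest l r Z us E eR wz wt wE uq

  cut-cascade {s} {y = y} {z} rest l r Z us E eR wz wt wE uq with cut-step s y z l r Z us E wz wt wE uq
  ... | y≢z , state = record
    { result = result ; result-roots = result-roots ; result-wf = result-wf
    ; result-occ = λ w → trans (result-occ w) (weight-cut (δ w) Z z l t r E)
    ; result-nodes = trans result-nodes (weight-cut (λ _ → 1) Z z l t r E)
    ; result-agree = λ w e → trans (result-agree w (trans (weight-cut (δ w) Z z l t r E) e))
                                   (cut-other s y z w (≢-sym (occ≡0⇒≢ (λ u → occ u G) e yG)) (≢-sym (occ≡0⇒≢ (λ u → occ u G) e zG)))
    ; result-keys = λ w → trans (result-keys w) (cut-key s y z w)
    ; result-roots-kept = λ w q → result-roots-kept w (cut-root s y z w q) }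
    where
    t = node y us
    G = plug Z (node z (l ++ t ∷ r)) ++ E
    yG : 1 ≤ occ y G
    yG = occ-plug-++ y (down l r z Z) t E (occ-label t)
    zG : 1 ≤ occ z G
    zG = occ-plug-++ z Z (node z (l ++ t ∷ r)) E (occ-label (node z (l ++ t ∷ r)))
    open CascadeResult (cascade-preserves rest Z (l ++ r) (E ++ [ t ])
                          (trans (cong (_++ [ y ]) eR) (sym (labels-cut Z z l t r E))) state)

  cascade-keeps-roots : ∀ {s R y s' R'} → CascCut s R y s' R' → ∀ w → w ∈ R → w ∈ R'
  cascade-keeps-roots (casc-root _) w p = p
  cascade-keeps-roots (casc-mark _ _) w p = p
  cascade-keeps-roots (casc-cut _ _ rest) w p = cascade-keeps-roots rest w (∈-++⁺ˡ p)

  module DecreaseKey {W : World} (I : Invariant W) (i : ℕ) (x : Id) (k : Key) (k≤x : k ≤ₖ key (store W x))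
                     (Z : Zipper) (ts : List Tree) (at : Invariant.forest I i ≡ plug Z (node x ts)) where
    open Invariant I
    s = store W
    H = heaps W i
    setK : Node → Node
    setK v = record v { key = k }
    s₁ = setKey s x k
    s₁x : s₁ x ≡ setK (s x)
    s₁x = update-≡ s x setK
    x-absent : (occZ x Z ≡ 0) × (occ x ts ≡ 0)
    x-absent = OccUnique-hole′ Z x ts (subst OccUnique at (unique i))
    xF : 1 ≤ occ x (forest i)
    xF = subst (λ G → 1 ≤ occ x G) (sym at) (occ-plug⁺ x Z (node x ts) (occ-label (node x ts)))
    wf-at = WfForest-plug⁻ s Z (node x ts) (subst (WfForest s) at (forest-wf i))
    hole : WfHole s Z (s x)
    hole = proj₁ (proj₂ wf-at)
    parent-x : parent (s₁ x) ≡ parent (s x)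
    parent-x = cong parent s₁x
    key-other : ∀ w → w ≢ x → key (s₁ w) ≡ key (s w)
    key-other w w≢x = cong key (update-≢ s x setK w w≢x)
    agree-outside : ∀ w → occ w (forest i) ≡ 0 → s₁ w ≡ s w
    agree-outside w e = update-≢ s x setK w (≢-sym (occ≡0⇒≢ (λ u → occ u (forest i)) e xF))
    wz₁ : WfZipper s₁ Z x
    wz₁ = WfZipper-agree s s₁ Z x (proj₁ wf-at) (agree-except s x setK (λ w → occZ w Z) (proj₁ x-absent))
    wt₁ : WfTree s₁ (node x ts)
    wt₁ = WfTree-agree-root s s₁ x ts (proj₂ (proj₂ wf-at)) (agree-except s x setK (λ w → occ w ts) (proj₂ x-absent))
            (subst (_≤ₖ key (s x)) (sym (cong key s₁x)) k≤x) (cong children s₁x)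

    min-after : ∀ s₂ G' → (∀ w → occ w G' ≡ occ w (forest i)) → (∀ w → key (s₂ w) ≡ key (s₁ w)) →
      parent (s₂ x) ≡ nothing → (∀ m → parent (s m) ≡ nothing → m ≢ x → parent (s₂ m) ≡ nothing) →
      MinCorrect s₂ G' (newMin s₂ (min H) x)
    min-after s₂ G' occ≡ key≡ x-root roots-kept =
      MinCorrect-newMin s₂ G' (min H) x x-root (subst (1 ≤_) (sym (occ≡ x)) xF)
        (λ e _ _ → ⊥-elim (occ-[]⁻ (proj₁ (minCorrect i) e) xF)) m-or-x
      where
      m-or-x : ∀ m → min H ≡ just m → (parent (s₂ m) ≡ nothing) × (1 ≤ occ m G') ×
                 (∀ z → 1 ≤ occ z G' → (key (s₂ m) ≤ₖ key (s₂ z)) ⊎ (key (s₂ x) ≤ₖ key (s₂ z)))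
      m-or-x m e with proj₂ (minCorrect i) m e
      ... | m-root , mF , m≤ = m-root′ , subst (1 ≤_) (sym (occ≡ m)) mF , compare-z
        where
        m-root′ : parent (s₂ m) ≡ nothing
        m-root′ with m ℕ.≟ x
        ... | yes refl = x-root
        ... | no m≢x = roots-kept m m-root m≢x
        compare-z : ∀ z → 1 ≤ occ z G' → (key (s₂ m) ≤ₖ key (s₂ z)) ⊎ (key (s₂ x) ≤ₖ key (s₂ z))
        compare-z z p with z ℕ.≟ x
        ... | yes refl = inj₂ ≤ₖ-refl
        ... | no z≢x with m ℕ.≟ x
        ...   | no m≢x rewrite key≡ m | key≡ z | key-other m m≢x | key-other z z≢x = inj₁ (m≤ z (subst (1 ≤_) (occ≡ z) p))
        ...   | yes refl rewrite key≡ x | key≡ z | cong key s₁x | key-other z z≢x =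
                  inj₂ (≤ₖ-trans k≤x (m≤ z (subst (1 ≤_) (occ≡ z) p)))

  module _ {W : World} (I : Invariant W) (i : ℕ) (x : Id) (k : Key) (k≤x : k ≤ₖ key (store W x)) where
    open Invariant I

    decreaseKey-root : ∀ l r ts (at : forest i ≡ plug (top l r) (node x ts)) → parent (setKey (store W) x k x) ≡ nothing →
      Invariant (mkWorld (setKey (store W) x k) (next W)
                 (setHeap (heaps W) i (mkHeap (roots (heaps W i)) (newMin (setKey (store W) x k) (min (heaps W i)) x) (size (heaps W i)))))
    decreaseKey-root l r ts at x-root =
      shrinkHeap-preserves I i s₁ _ (forest i) (subst (WfForest s₁) (sym at) (WfForest-plug⁺ s₁ (top l r) (node x ts) wz₁ x-root wt₁))
        (roots≡labels i) (λ _ → ≤-refl) (nodes≤size i)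
        (min-after s₁ (forest i) (λ _ → refl) (λ _ → refl) x-root (λ m q m≢x → trans (cong parent (update-≢ s x setK m m≢x)) q))
        agree-outside
      where open DecreaseKey I i x k k≤x (top l r) ts at

    decreaseKey-noCut : ∀ l r y Z' ts (at : forest i ≡ plug (down l r y Z') (node x ts)) →
      parent (setKey (store W) x k x) ≡ just y → ¬ (k <ₖ key (setKey (store W) x k y)) →
      Invariant (mkWorld (setKey (store W) x k) (next W)
                 (setHeap (heaps W) i (mkHeap (roots (heaps W i)) (newMin (setKey (store W) x k) (min (heaps W i)) x) (size (heaps W i)))))
    decreaseKey-noCut l r y Z' ts at x↑y y≤k =
      shrinkHeap-preserves I i s₁ _ (forest i) (subst (WfForest s₁) (sym at) (WfForest-plug⁺ s₁ (down l r y Z') (node x ts) wz₁ hole₁ wt₁))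
        (roots≡labels i) (λ _ → ≤-refl) (nodes≤size i) (min-kept (min H) (minCorrect i)) agree-outside
      where
      open DecreaseKey I i x k k≤x (down l r y Z') ts at
      hole₁ : WfHole s₁ (down l r y Z') (s₁ x)
      hole₁ = x↑y , subst (λ u → ¬ (u <ₖ key (s₁ y))) (sym (cong key s₁x)) y≤k ,
              subst (λ v → length l ≤ degree v + markBit v) (sym s₁x) (proj₂ (proj₂ hole))
      y≢x : y ≢ x
      y≢x y≡x = δ≡0⇒≢ x y (m+n≡0⇒m≡0 _ (m+n≡0⇒m≡0 _ (proj₁ x-absent))) (sym y≡x)
      yF : 1 ≤ occ y (forest i)
      yF = subst (λ G → 1 ≤ occ y G) (sym at) (occ-plug⁺ y Z' (node y (l ++ node x ts ∷ r)) (occ-label (node y (l ++ node x ts ∷ r))))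
      -- x stays below y, whose key is at least the minimum's, so the minimum is unchanged
      min-kept : ∀ mn → MinCorrect s (forest i) mn → MinCorrect s₁ (forest i) (newMin s₁ mn x)
      min-kept nothing (empty , _) = ⊥-elim (occ-[]⁻ (empty refl) xF)
      min-kept (just m) (_ , isMin) with isMin m refl
      ... | m-root , mF , m≤ with key (s₁ x) <ₖ? key (s₁ m)
      ...   | yes x<m = ⊥-elim (y≤k (<-≤ₖ-trans (subst (_<ₖ key (s₁ m)) (cong key s₁x) x<m)
                          (subst₂ _≤ₖ_ (sym (key-other m m≢x)) (sym (key-other y y≢x)) (m≤ y yF))))
        where
        m≢x : m ≢ x
        m≢x refl = just≢nothing (trans (sym (proj₁ hole)) m-root)
      ...   | no x≮m = (λ ()) , λ { _ refl → trans (cong parent (update-≢ s x setK m m≢x)) m-root , mF , m≤′ }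
        where
        m≢x : m ≢ x
        m≢x refl = just≢nothing (trans (sym (proj₁ hole)) m-root)
        m≤′ : ∀ z → 1 ≤ occ z (forest i) → key (s₁ m) ≤ₖ key (s₁ z)
        m≤′ z p = by-cases (z ℕ.≟ x)
          where
          by-cases : Dec (z ≡ x) → key (s₁ m) ≤ₖ key (s₁ z)
          by-cases (yes refl) = x≮m
          by-cases (no z≢x) rewrite key-other m m≢x | key-other z z≢x = m≤ z p

    decreaseKey-cut : ∀ l r y Z' ts s' R' (at : forest i ≡ plug (down l r y Z') (node x ts)) →
      CascCut (cut (setKey (store W) x k) x y) (roots (heaps W i) ++ [ x ]) y s' R' →
      Invariant (mkWorld s' (next W) (setHeap (heaps W) i (mkHeap R' (newMin s' (min (heaps W i)) x) (size (heaps W i)))))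
    decreaseKey-cut l r y Z' ts s' R' at cascade =
      shrinkHeap-preserves I i s' _ result result-wf result-roots (λ w → ≤-reflexive (occ≡ w))
        (≤-trans (≤-reflexive (trans result-nodes (cong nodes F₀≡))) (nodes≤size i))
        (min-after s' result occ≡ result-keys x-root (λ m q m≢x → result-roots-kept m (trans (cong parent (update-≢ s x setK m m≢x)) q)))
        (λ w e → trans (result-agree w (trans (cong (occ w) F₀≡) e)) (agree-outside w e))
      where
      open DecreaseKey I i x k k≤x (down l r y Z') ts at
      F₀ = plug Z' (node y (l ++ node x ts ∷ r))
      F₀≡ : F₀ ++ [] ≡ forest i
      F₀≡ = trans (++-identityʳ F₀) (sym at)
      open CascadeResult (cut-cascade cascade l r Z' ts [] (trans (roots≡labels i) (cong (map label) (sym F₀≡))) wz₁ wt₁ tt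
                            (subst OccUnique (sym F₀≡) (unique i)))
      occ≡ : ∀ w → occ w result ≡ occ w (forest i)
      occ≡ w = trans (result-occ w) (cong (occ w) F₀≡)
      x-root : parent (s' x) ≡ nothing
      x-root = WfForest-root s' result x result-wf (subst (x ∈_) result-roots (cascade-keeps-roots cascade x (∈-++⁺ʳ (roots H) (here refl))))

    decreaseKey-at : ∀ {s' h'} Z ts → forest i ≡ plug Z (node x ts) → DecKey (store W) (heaps W i) x k s' h' →
      Invariant (mkWorld s' (next W) (setHeap (heaps W) i h'))
    decreaseKey-at (top l r) ts at (dk-root x-root) = decreaseKey-root l r ts at x-root
    decreaseKey-at (top l r) ts at (dk-ok x↑ _) = ⊥-elim (just≢nothing (trans (sym x↑) (trans parent-x hole)))
      where open DecreaseKey I i x k k≤x (top l r) ts at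
    decreaseKey-at (top l r) ts at (dk-cut x↑ _ _) = ⊥-elim (just≢nothing (trans (sym x↑) (trans parent-x hole)))
      where open DecreaseKey I i x k k≤x (top l r) ts at
    decreaseKey-at (down l r y Z') ts at (dk-root x-root) = ⊥-elim (just≢nothing (trans (sym (proj₁ hole)) (trans (sym parent-x) x-root)))
      where open DecreaseKey I i x k k≤x (down l r y Z') ts at
    decreaseKey-at (down l r y Z') ts at (dk-ok x↑ y≤k) with just-injective (trans (sym (proj₁ hole)) (trans (sym parent-x) x↑))
      where open DecreaseKey I i x k k≤x (down l r y Z') ts at
    ... | refl = decreaseKey-noCut l r y Z' ts at x↑ y≤k
    decreaseKey-at (down l r y Z') ts at (dk-cut x↑ _ cascade) with just-injective (trans (sym (proj₁ hole)) (trans (sym parent-x) x↑))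
      where open DecreaseKey I i x k k≤x (down l r y Z') ts at
    ... | refl = decreaseKey-cut l r y Z' ts _ _ at cascade

  decreaseKey-preserves : ∀ {W i x k s' h'} → (I : Invariant W) → InHeap W i x → ¬ (key (store W x) <ₖ k) →
    DecKey (store W) (heaps W i) x k s' h' → Invariant (mkWorld s' (next W) (setHeap (heaps W) i h'))
  decreaseKey-preserves {_} {i} {x} {k} I x∈ k≤x dk with locate x (Invariant.forest I i) (InHeap⇒occ I i x x∈)
  ... | Z , ts , at = decreaseKey-at I i x k k≤x Z ts at dk

  -- Linking and consolidation

  detach-root : ∀ s y → parent (s y) ≡ nothing → detach s y ≡ s
  detach-root s y p with parent (s y)
  ... | nothing = refl
  detach-root s y () | just _

  addChild : Id → Node → Node
  addChild c v = record v { children = children v ++ [ c ] }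

  setParent : Id → Node → Node
  setParent p v = record v { parent = just p ; mark = false }

  degree-addChild : ∀ c v → degree (addChild c v) ≡ suc (degree v)
  degree-addChild c v = trans (length-++ (children v)) (+-comm (degree v) 1)

  module _ (s : Store) (c p : Id) (c-root : parent (s c) ≡ nothing) (c≢p : c ≢ p) where

    link≡ : link s c p ≡ update (update s p (addChild c)) c (setParent p)
    link≡ rewrite detach-root s c c-root = refl

    link-child : link s c p c ≡ setParent p (s c)
    link-child = trans (cong (λ s′ → s′ c) link≡) (trans (update-≡ _ c (setParent p)) (cong (setParent p) (update-≢ s p _ c c≢p)))

    link-parent : link s c p p ≡ addChild c (s p)
    link-parent = trans (cong (λ s′ → s′ p) link≡) (trans (update-≢ _ c (setParent p) p (≢-sym c≢p)) (update-≡ s p _))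

    link-other : ∀ w → w ≢ c → w ≢ p → link s c p w ≡ s w
    link-other w w≢c w≢p = trans (cong (λ s′ → s′ w) link≡) (trans (update-≢ _ c (setParent p) w w≢c) (update-≢ s p _ w w≢p))

    link-child-nonroot : parent (link s c p c) ≢ nothing
    link-child-nonroot e = just≢nothing (trans (sym (cong parent link-child)) e)

    link-root⁻ : ∀ w → parent (link s c p w) ≡ nothing → parent (s w) ≡ nothing
    link-root⁻ w = by-cases (w ℕ.≟ c) (w ℕ.≟ p)
      where
      by-cases : Dec (w ≡ c) → Dec (w ≡ p) → parent (link s c p w) ≡ nothing → parent (s w) ≡ nothing
      by-cases (yes refl) _ _ = c-root
      by-cases (no _) (yes refl) q = trans (sym (cong parent link-parent)) q
      by-cases (no w≢c) (no w≢p) q = trans (sym (cong parent (link-other w w≢c w≢p))) q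

    link-root⁺ : ∀ w → parent (s w) ≡ nothing → w ≢ c → parent (link s c p w) ≡ nothing
    link-root⁺ w w-root w≢c = by-cases (w ℕ.≟ p)
      where
      by-cases : Dec (w ≡ p) → parent (link s c p w) ≡ nothing
      by-cases (yes refl) = trans (cong parent link-parent) w-root
      by-cases (no w≢p) = trans (cong parent (link-other w w≢c w≢p)) w-root

    link-degree-mono : ∀ w → degree (s w) ≤ degree (link s c p w)
    link-degree-mono w = by-cases (w ℕ.≟ c) (w ℕ.≟ p)
      where
      by-cases : Dec (w ≡ c) → Dec (w ≡ p) → degree (s w) ≤ degree (link s c p w)
      by-cases (yes refl) _ = ≤-reflexive (sym (cong degree link-child))
      by-cases (no _) (yes refl) = ≤-trans (n≤1+n _) (≤-reflexive (sym (trans (cong degree link-parent) (degree-addChild c (s p)))))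
      by-cases (no w≢c) (no w≢p) = ≤-reflexive (sym (cong degree (link-other w w≢c w≢p)))

    -- c becomes child number degree p of p, and degree c ≥ degree p pays for that position
    link-wfTree : ∀ cs ps → WfTree s (node p ps) → WfTree s (node c cs) →
      occ c ps ≡ 0 → occ p ps ≡ 0 → occ c cs ≡ 0 → occ p cs ≡ 0 →
      key (s p) ≤ₖ key (s c) → degree (s p) ≤ degree (s c) → WfTree (link s c p) (node p (ps ++ [ node c cs ]))
    link-wfTree cs ps (chp , wfp) wtc cps pps ccs pcs p≤c deg≤ =
      trans (map-++ label ps [ node c cs ]) (trans (cong (_++ [ c ]) chp) (sym (cong children link-parent))) ,
      WfChildren-++ s₁ p 0 ps [ node c cs ] (WfChildren-agree s s₁ p 0 ps wfp (agree (λ w → occ w ps) cps pps) (≡⇒≤ₖ (cong key link-parent)))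
        (c-at , WfTree-agree-root s s₁ c cs wtc (agree (λ w → occ w cs) ccs pcs) (≡⇒≤ₖ (cong key link-child)) (cong children link-child) , tt)
      where
      s₁ = link s c p
      agree : (o : Id → ℕ) → o c ≡ 0 → o p ≡ 0 → AgreeOn s s₁ o
      agree o oc op w q = link-other w (occ≡0⇒≢ o oc q) (occ≡0⇒≢ o op q)
      c-at : ChildAt p (key (s₁ p)) (length ps) (s₁ c)
      c-at = subst (ChildAt p (key (s₁ p)) (length ps)) (sym link-child)
               (refl , subst (_≤ₖ key (s c)) (sym (cong key link-parent)) p≤c ,
                ≤-trans (≤-reflexive (sym (degree≡length s p ps chp))) (≤-trans deg≤ (m≤m+n _ 0)))

    link-hole : ∀ Z → WfHole s Z (s p) → AgreeOn s (link s c p) (λ w → occZ w Z) → WfHole (link s c p) Z (link s c p p)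
    link-hole Z hole on-Z =
      WfHole-mono (link s c p) Z (s p) (link s c p p) (WfHole-agree s (link s c p) Z (s p) hole on-Z) (cong parent link-parent)
        (≡⇒≤ₖ (sym (cong key link-parent)))
        (subst (λ v → degree (s p) + markBit (s p) ≤ degree v + markBit v) (sym link-parent)
          (+-monoˡ-≤ (markBit (s p)) (≤-trans (n≤1+n _) (≤-reflexive (sym (degree-addChild c (s p)))))))

  record LinkResult (s : Store) (G : List Tree) (c p : Id) : Set where
    field
      linked       : List Tree
      linked-wf    : WfForest (link s c p) linked
      linked-occ   : ∀ w → occ w linked ≡ occ w G
      linked-nodes : nodes linked ≡ nodes G

  link-preserves : ∀ s G c p → WfForest s G → OccUnique G → parent (s c) ≡ nothing → 1 ≤ occ c G → 1 ≤ occ p G → c ≢ p →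
    (∀ cs → WfTree s (node c cs) → 1 ≤ occ p cs → ⊥) → key (s p) ≤ₖ key (s c) → degree (s p) ≤ degree (s c) → LinkResult s G c p
  link-preserves s G c p wG uG c-root cG pG c≢p p∉c p≤c deg≤ with root-split s G c wG cG c-root
  ... | pre , cs , post , refl = record
    { linked = plug Zp (node p (ps ++ [ t ]))
    ; linked-wf = WfForest-plug⁺ s₁ Zp (node p (ps ++ [ t ])) wz₁ hole₁
        (link-wfTree s c p c-root c≢p cs ps wtp (proj₁ (proj₂ (WfForest-mid s pre t post wG))) c∉ps (proj₂ p-absent) c∉cs p∉cs p≤c deg≤)
    ; linked-occ = λ w → weight-link (δ w) pre t post Zp p ps at
    ; linked-nodes = weight-link (λ _ → 1) pre t post Zp p ps at }
    where
    t = node c cs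
    G₁ = pre ++ post
    wG₁ : WfForest s G₁
    wG₁ = proj₂ (proj₂ (WfForest-mid s pre t post wG))
    c-absent : (occ c pre + occ c post ≡ 0) × (occ c cs ≡ 0)
    c-absent = OccUnique-hole′ (top pre post) c cs uG
    c∉cs = proj₂ c-absent
    c∉G₁ : occ c G₁ ≡ 0
    c∉G₁ = trans (occ-++ c pre post) (proj₁ c-absent)
    p∉cs : occ p cs ≡ 0
    p∉cs with occ p cs in e
    ... | zero = refl
    ... | suc _ = ⊥-elim (p∉c cs (proj₁ (proj₂ (WfForest-mid s pre t post wG))) (subst (1 ≤_) (sym e) (s≤s z≤n)))
    pG₁ : 1 ≤ occ p G₁
    pG₁ = subst (1 ≤_) (trans (occ-mid p pre t post) (trans (cong (occ p G₁ +_) p∉t) (+-identityʳ _))) pG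
      where
      p∉t : occT p t ≡ 0
      p∉t = trans (cong (_+ occ p cs) (δ-≢ p c (≢-sym c≢p))) p∉cs
    L = locate p G₁ pG₁
    Zp = proj₁ L
    ps = proj₁ (proj₂ L)
    at : G₁ ≡ plug Zp (node p ps)
    at = proj₂ (proj₂ L)
    wfp = WfForest-plug⁻ s Zp (node p ps) (subst (WfForest s) at wG₁)
    wtp = proj₂ (proj₂ wfp)
    p-absent : (occZ p Zp ≡ 0) × (occ p ps ≡ 0)
    p-absent = OccUnique-hole′ Zp p ps (λ w → subst (λ G → occ w G ≤ 1) at
                 (≤-trans (m≤m+n _ (occT w t)) (≤-trans (≤-reflexive (sym (occ-mid w pre t post))) (uG w))))
    c∉Zp+ps : occZ c Zp + (δ c p + occ c ps) ≡ 0
    c∉Zp+ps = trans (sym (occ-plug c Zp (node p ps))) (trans (cong (occ c) (sym at)) c∉G₁)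
    c∉ps : occ c ps ≡ 0
    c∉ps = m+n≡0⇒n≡0 (δ c p) (m+n≡0⇒n≡0 (occZ c Zp) c∉Zp+ps)
    s₁ = link s c p
    on-Zp : AgreeOn s s₁ (λ w → occZ w Zp)
    on-Zp w q = link-other s c p c-root c≢p w
                  (occ≡0⇒≢ (λ u → occZ u Zp) (m+n≡0⇒m≡0 _ c∉Zp+ps) q) (occ≡0⇒≢ (λ u → occZ u Zp) (proj₁ p-absent) q)
    wz₁ : WfZipper s₁ Zp p
    wz₁ = WfZipper-agree s s₁ Zp p (proj₁ wfp) on-Zp
    hole₁ : WfHole s₁ Zp (s₁ p)
    hole₁ = link-hole s c p c-root c≢p Zp (proj₁ (proj₂ wfp)) on-Zp

  setA-cases : ∀ A d x e w → setA A d x e ≡ just w → ((e ≡ d) × (w ≡ x)) ⊎ ((e ≢ d) × (A e ≡ just w))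
  setA-cases A d x e w p with e ℕ.≟ d
  ... | yes e≡d = inj₁ (e≡d , just-injective (sym p))
  ... | no e≢d = inj₂ (e≢d , p)

  setA-≢ : ∀ A d x e → e ≢ d → setA A d x e ≡ A e
  setA-≢ A d x e e≢d with e ℕ.≟ d
  ... | yes e≡d = ⊥-elim (e≢d e≡d)
  ... | no _ = refl

  -- entry-degree is what makes the second case of APPEND link a root at a valid position.
  record ArrayInv (s : Store) (G : List Tree) (A : Arr) : Set where
    field
      arr-wf       : WfForest s G
      arr-unique   : OccUnique G
      entry-occ    : ∀ e y → A e ≡ just y → 1 ≤ occ y G
      entry-degree : ∀ e y → A e ≡ just y → parent (s y) ≡ nothing → e ≤ degree (s y)

  ArrayInjective : Store → Arr → Set
  ArrayInjective s A = ∀ e e' y → A e ≡ just y → A e' ≡ just y → parent (s y) ≡ nothing → e ≡ e'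

  ArrayInjectiveExcept : Store → Arr → Id → Set
  ArrayInjectiveExcept s A x = ∀ e e' y → A e ≡ just y → A e' ≡ just y → parent (s y) ≡ nothing → y ≢ x → e ≡ e'

  ArrayInv-link : ∀ s G A c p → ArrayInv s G A → (L : LinkResult s G c p) → parent (s c) ≡ nothing → c ≢ p →
    ArrayInv (link s c p) (LinkResult.linked L) A
  ArrayInv-link s G A c p inv L c-root c≢p = record
    { arr-wf = linked-wf
    ; arr-unique = λ w → subst (_≤ 1) (sym (linked-occ w)) (arr-unique w)
    ; entry-occ = λ e y q → subst (1 ≤_) (sym (linked-occ y)) (entry-occ e y q)
    ; entry-degree = λ e y q y-root → ≤-trans (entry-degree e y q (link-root⁻ s c p c-root c≢p y y-root)) (link-degree-mono s c p c-root c≢p y) }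
    where
    open ArrayInv inv
    open LinkResult L

  EntryOrigin : Arr → Id → ℕ → Arr → Set
  EntryOrigin A x d A' = ∀ e w → A' e ≡ just w → (A e ≡ just w) ⊎ ((w ≡ x) ⊎ (Σ ℕ λ e' → (d ≤ e') × (A e' ≡ just w)))

  record StoreStep (s : Store) (G : List Tree) (A : Arr) (x : Id) (s' : Store) : Set where
    field
      roots-reflect     : ∀ w → parent (s' w) ≡ nothing → parent (s w) ≡ nothing
      degree-mono       : ∀ w → degree (s w) ≤ degree (s' w)
      roots-kept        : ∀ w → parent (s w) ≡ nothing → w ≢ x → (∀ e → A e ≢ just w) → parent (s' w) ≡ nothing
      outside-unchanged : ∀ w → occ w G ≡ 0 → s' w ≡ s w

  StoreStep-refl : ∀ s G A x → StoreStep s G A x s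
  StoreStep-refl s G A x = record
    { roots-reflect = λ _ q → q ; degree-mono = λ _ → ≤-refl ; roots-kept = λ _ q _ _ → q ; outside-unchanged = λ _ _ → refl }

  record AppendResult (s : Store) (G : List Tree) (A : Arr) (x : Id) (d : ℕ) (s' : Store) (A' : Arr) : Set where
    field
      forest′         : List Tree
      arrayInv        : ArrayInv s' forest′ A'
      injective       : ArrayInjectiveExcept s' A' x
      occ≡            : ∀ w → occ w forest′ ≡ occ w G
      nodes≡          : nodes forest′ ≡ nodes G
      below-unchanged : ∀ e → e < d → A' e ≡ A e
      x-entries       : parent (s' x) ≡ nothing → ∀ e → A' e ≡ just x → (e ≡ d) ⊎ (A e ≡ just x)
      entry-origin    : EntryOrigin A x d A'
      step            : StoreStep s G A x s'

  -- what holds just before the final assignment A[d] := x of APPEND(x, d, A)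
  record BeforeStore (s : Store) (G : List Tree) (A : Arr) (x : Id) (d : ℕ) (s' : Store) (A' : Arr) : Set where
    field
      forest⁻       : List Tree
      arrayInv⁻     : ArrayInv s' forest⁻ A'
      occ≡⁻         : ∀ w → occ w forest⁻ ≡ occ w G
      nodes≡⁻       : nodes forest⁻ ≡ nodes G
      x-occ         : 1 ≤ occ x forest⁻
      x-degree      : parent (s' x) ≡ nothing → d ≤ degree (s' x)
      injective⁻    : ∀ e e' y → A' e ≡ just y → A' e' ≡ just y → parent (s' y) ≡ nothing → y ≢ x → e ≢ d → e' ≢ d → e ≡ e'
      below⁻        : ∀ e → e < d → A' e ≡ A e
      x-entries⁻    : parent (s' x) ≡ nothing → ∀ e → A' e ≡ just x → (e ≡ d) ⊎ (A e ≡ just x)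
      entry-origin⁻ : EntryOrigin A x d A'
      step⁻         : StoreStep s G A x s'

  store-x : ∀ {s G A x d s' A'} → BeforeStore s G A x d s' A' → AppendResult s G A x d s' (setA A' d x)
  store-x {s} {G} {A} {x} {d} {s'} {A'} before = record
    { forest′ = forest⁻ ; arrayInv = inv ; injective = inj ; occ≡ = occ≡⁻ ; nodes≡ = nodes≡⁻
    ; below-unchanged = λ e e<d → trans (setA-≢ A' d x e (λ e≡d → <-irrefl e≡d e<d)) (below⁻ e e<d)
    ; x-entries = x-entries′ ; entry-origin = origin ; step = step⁻ }
    where
    open BeforeStore before
    open ArrayInv arrayInv⁻
    inv : ArrayInv s' forest⁻ (setA A' d x)
    inv = record { arr-wf = arr-wf ; arr-unique = arr-unique
      ; entry-occ = λ e y p → [ (λ { (_ , refl) → x-occ }) , (λ { (_ , q) → entry-occ e y q }) ]′ (setA-cases A' d x e y p)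
      ; entry-degree = λ e y p y-root →
          [ (λ { (refl , refl) → x-degree y-root }) , (λ { (_ , q) → entry-degree e y q y-root }) ]′ (setA-cases A' d x e y p) }
    inj : ArrayInjectiveExcept s' (setA A' d x) x
    inj e e' y p p' y-root y≢x with setA-cases A' d x e y p | setA-cases A' d x e' y p'
    ... | inj₁ (_ , y≡x) | _ = ⊥-elim (y≢x y≡x)
    ... | _ | inj₁ (_ , y≡x) = ⊥-elim (y≢x y≡x)
    ... | inj₂ (e≢d , q) | inj₂ (e'≢d , q') = injective⁻ e e' y q q' y-root y≢x e≢d e'≢d
    x-entries′ : parent (s' x) ≡ nothing → ∀ e → setA A' d x e ≡ just x → (e ≡ d) ⊎ (A e ≡ just x)
    x-entries′ x-root e p with setA-cases A' d x e x p
    ... | inj₁ (e≡d , _) = inj₁ e≡d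
    ... | inj₂ (_ , q) = x-entries⁻ x-root e q
    origin : EntryOrigin A x d (setA A' d x)
    origin e w p with setA-cases A' d x e w p
    ... | inj₁ (_ , w≡x) = inj₂ (inj₁ w≡x)
    ... | inj₂ (_ , q) = entry-origin⁻ e w q

  before-unchanged : ∀ {s G A x d} → ArrayInv s G A → ArrayInjective s A → degree (s x) ≡ d → 1 ≤ occ x G → BeforeStore s G A x d s A
  before-unchanged {s} {G} {A} {x} inv inj deg-x x∈G = record
    { forest⁻ = G ; arrayInv⁻ = inv ; occ≡⁻ = λ _ → refl ; nodes≡⁻ = refl ; x-occ = x∈G ; x-degree = λ _ → ≤-reflexive (sym deg-x)
    ; injective⁻ = λ e e' y q q' y-root _ _ _ → inj e e' y q q' y-root ; below⁻ = λ _ _ → refl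
    ; x-entries⁻ = λ _ _ q → inj₂ q ; entry-origin⁻ = λ _ _ q → inj₁ q ; step⁻ = StoreStep-refl s G A x }

  -- Restores injectivity after a nested APPEND(y, d', A) that may have moved y to d'.
  injective-restore : ∀ {s : Store} {A A' : Arr} y d' (Q : ℕ → Set) → ArrayInjectiveExcept s A' y →
    (parent (s y) ≡ nothing → ∀ e → A' e ≡ just y → (e ≡ d') ⊎ (A e ≡ just y)) → (∀ e → Q e → A e ≢ just y) →
    ∀ e e' z → A' e ≡ just z → A' e' ≡ just z → parent (s z) ≡ nothing → Q e → Q e' → e ≡ e'
  injective-restore y d' Q inj y-entries y-fresh e e' z q q' z-root Qe Qe' with z ℕ.≟ y
  ... | no z≢y = inj e e' z q q' z-root z≢y
  ... | yes refl with y-entries z-root e q | y-entries z-root e' q'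
  ...   | inj₁ e≡d' | inj₁ e'≡d' = trans e≡d' (sym e'≡d')
  ...   | inj₂ old | _ = ⊥-elim (y-fresh e Qe old)
  ...   | _ | inj₂ old = ⊥-elim (y-fresh e' Qe' old)

  origin-nested : ∀ {A A'} x y d d' → d ≤ d' → A d ≡ just y → EntryOrigin A y d' A' → EntryOrigin A x d A'
  origin-nested x y d d' d≤d' Ad origin e w q with origin e w q
  ... | inj₁ old = inj₁ old
  ... | inj₂ (inj₁ refl) = inj₂ (inj₂ (d , ≤-refl , Ad))
  ... | inj₂ (inj₂ (e' , d'≤e' , Ae')) = inj₂ (inj₂ (e' , ≤-trans d≤d' d'≤e' , Ae'))

  StoreStep-link : ∀ s G A x c p → parent (s c) ≡ nothing → c ≢ p → 1 ≤ occ c G → 1 ≤ occ p G →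
    (∀ w → w ≢ x → (∀ e → A e ≢ just w) → w ≢ c) → StoreStep s G A x (link s c p)
  StoreStep-link s G A x c p c-root c≢p c∈G p∈G kept-≢c = record
    { roots-reflect = link-root⁻ s c p c-root c≢p ; degree-mono = link-degree-mono s c p c-root c≢p
    ; roots-kept = λ w w-root w≢x notA → link-root⁺ s c p c-root c≢p w w-root (kept-≢c w w≢x notA)
    ; outside-unchanged = λ w o → link-other s c p c-root c≢p w
        (≢-sym (occ≡0⇒≢ (λ u → occ u G) o c∈G)) (≢-sym (occ≡0⇒≢ (λ u → occ u G) o p∈G)) }

  StoreStep-trans : ∀ {s G A x s₁ G₁ y s'} → StoreStep s G A x s₁ → StoreStep s₁ G₁ A y s' → (∀ w → occ w G₁ ≡ occ w G) →
    (∀ w → w ≢ x → (∀ e → A e ≢ just w) → w ≢ y) → StoreStep s G A x s'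
  StoreStep-trans first second occ≡ kept-≢y = record
    { roots-reflect = λ w q → roots-reflect first w (roots-reflect second w q)
    ; degree-mono = λ w → ≤-trans (degree-mono first w) (degree-mono second w)
    ; roots-kept = λ w w-root w≢x notA → roots-kept second w (roots-kept first w w-root w≢x notA) (kept-≢y w w≢x notA) notA
    ; outside-unchanged = λ w o → trans (outside-unchanged second w (trans (occ≡ w) o)) (outside-unchanged first w o) }
    where open StoreStep

  module AppendCase {s A x d y G} (inv : ArrayInv s G A) (inj : ArrayInjective s A) (x-root : parent (s x) ≡ nothing)
                    (deg-x : degree (s x) ≡ d) (x∈G : 1 ≤ occ x G) (x-fresh : ∀ e → A e ≡ just x → e < d) (Ad : A d ≡ just y) where
    open ArrayInv inv public
    y∈G : 1 ≤ occ y G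
    y∈G = entry-occ d y Ad
    y≢x : y ≢ x
    y≢x y≡x = <-irrefl refl (x-fresh d (subst (λ u → A d ≡ just u) y≡x Ad))
    kept-≢y : ∀ w → w ≢ x → (∀ e → A e ≢ just w) → w ≢ y
    kept-≢y w _ notA w≡y = notA d (subst (λ u → A d ≡ just u) (sym w≡y) Ad)

  -- y ≥ x: the root y is linked below x as its d-th child
  append-adopt : ∀ {s A x d y G} → ArrayInv s G A → ArrayInjective s A → parent (s x) ≡ nothing → degree (s x) ≡ d → 1 ≤ occ x G →
    (∀ e → A e ≡ just x → e < d) → A d ≡ just y → ¬ (key (s y) <ₖ key (s x)) → parent (s y) ≡ nothing →
    BeforeStore s G A x d (link s y x) A
  append-adopt {s} {A} {x} {d} {y} {G} inv inj x-root deg-x x∈G x-fresh Ad x≤y y-root = record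
    { forest⁻ = linked ; arrayInv⁻ = ArrayInv-link s G A y x inv L y-root y≢x ; occ≡⁻ = linked-occ ; nodes≡⁻ = linked-nodes
    ; x-occ = subst (1 ≤_) (sym (linked-occ x)) x∈G
    ; x-degree = λ _ → ≤-trans (≤-reflexive (sym deg-x)) (link-degree-mono s y x y-root y≢x x)
    ; injective⁻ = λ e e' z q q' z-root _ _ _ → inj e e' z q q' (link-root⁻ s y x y-root y≢x z z-root)
    ; below⁻ = λ _ _ → refl ; x-entries⁻ = λ _ _ q → inj₂ q ; entry-origin⁻ = λ _ _ q → inj₁ q
    ; step⁻ = StoreStep-link s G A x y x y-root y≢x y∈G x∈G kept-≢y }
    where
    open AppendCase inv inj x-root deg-x x∈G x-fresh Ad
    L = link-preserves s G y x arr-wf arr-unique y-root y∈G x∈G y≢x (λ cs wt q → proj₁ (heapOrderT s y cs x wt q) x-root) x≤y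
          (subst (_≤ degree (s y)) (sym deg-x) (entry-degree d y Ad y-root))
    open LinkResult L

  -- y < x and degree y = d: x is linked below y as its d-th child
  module LinkBelow {s A x d y G} (inv : ArrayInv s G A) (inj : ArrayInjective s A) (x-root : parent (s x) ≡ nothing)
                   (deg-x : degree (s x) ≡ d) (x∈G : 1 ≤ occ x G) (x-fresh : ∀ e → A e ≡ just x → e < d) (Ad : A d ≡ just y)
                   (y<x : key (s y) <ₖ key (s x)) (deg-y : degree (s y) ≡ d) where
    open AppendCase inv inj x-root deg-x x∈G x-fresh Ad public
    x≢y : x ≢ y
    x≢y = ≢-sym y≢x
    L = link-preserves s G x y arr-wf arr-unique x-root x∈G y∈G x≢y (λ cs wt q → proj₂ (heapOrderT s x cs y wt q) y<x)
          (<⇒≤ₖ y<x) (≤-reflexive (trans deg-y (sym deg-x)))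
    open LinkResult L public
    s₁ = link s x y
    inv₁ : ArrayInv s₁ linked A
    inv₁ = ArrayInv-link s G A x y inv L x-root x≢y
    inj₁′ : ArrayInjective s₁ A
    inj₁′ e e' z q q' z-root = inj e e' z q q' (link-root⁻ s x y x-root x≢y z z-root)
    x∈G₁ : 1 ≤ occ x linked
    x∈G₁ = subst (1 ≤_) (sym (linked-occ x)) x∈G
    y∈G₁ : 1 ≤ occ y linked
    y∈G₁ = subst (1 ≤_) (sym (linked-occ y)) y∈G
    x-nonroot : parent (s₁ x) ≢ nothing
    x-nonroot = link-child-nonroot s x y x-root x≢y
    deg-y₁ : degree (s₁ y) ≡ suc d
    deg-y₁ = trans (cong degree (link-parent s x y x-root x≢y)) (trans (degree-addChild x (s y)) (cong suc deg-y))
    step₁ : StoreStep s G A x s₁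
    step₁ = StoreStep-link s G A x x y x-root x≢y x∈G y∈G (λ _ w≢x _ → w≢x)

  append-preserves : ∀ {s A x d s' A'} → Append s A x d s' A' → ∀ G → ArrayInv s G A → ArrayInjective s A →
    parent (s x) ≡ nothing → degree (s x) ≡ d → 1 ≤ occ x G → (∀ e → A e ≡ just x → e < d) → AppendResult s G A x d s' A'
  append-link : ∀ {s A x d y s' A'' G} → ArrayInv s G A → ArrayInjective s A →
    parent (s x) ≡ nothing → degree (s x) ≡ d → 1 ≤ occ x G → (∀ e → A e ≡ just x → e < d) →
    A d ≡ just y → key (s y) <ₖ key (s x) → degree (s y) ≡ d →
    AppendIfRoot (link s x y) A y s' A'' → BeforeStore s G A x d s' A''
  append-pass : ∀ {s A x d y s' A'' G} → ArrayInv s G A → ArrayInjective s A →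
    parent (s x) ≡ nothing → degree (s x) ≡ d → 1 ≤ occ x G → (∀ e → A e ≡ just x → e < d) →
    A d ≡ just y → degree (s y) ≢ d → AppendIfRoot s A y s' A'' → BeforeStore s G A x d s' A''

  append-preserves (ap-nil Ad) G inv inj x-root deg-x x∈G x-fresh = store-x (before-unchanged inv inj deg-x x∈G)
  append-preserves {s} (ap-geq {y = y} Ad x≤y) G inv inj x-root deg-x x∈G x-fresh with parent (s y) in y-root
  ... | just _ = store-x (before-unchanged inv inj deg-x x∈G)
  ... | nothing = store-x (append-adopt inv inj x-root deg-x x∈G x-fresh Ad x≤y y-root)
  append-preserves {s} {d = d} (ap-less {y = y} Ad y<x next) G inv inj x-root deg-x x∈G x-fresh with degree (s y) ℕ.≟ d
  ... | yes deg-y = store-x (append-link inv inj x-root deg-x x∈G x-fresh Ad y<x deg-y next)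
  ... | no deg-y = store-x (append-pass inv inj x-root deg-x x∈G x-fresh Ad deg-y next)

  append-link inv inj x-root deg-x x∈G x-fresh Ad y<x deg-y (air-skip _) = record
    { forest⁻ = linked ; arrayInv⁻ = inv₁ ; occ≡⁻ = linked-occ ; nodes≡⁻ = linked-nodes ; x-occ = x∈G₁
    ; x-degree = λ x-root₁ → ⊥-elim (x-nonroot x-root₁)
    ; injective⁻ = λ e e' z q q' z-root _ _ _ → inj₁′ e e' z q q' z-root ; below⁻ = λ _ _ → refl
    ; x-entries⁻ = λ x-root₁ → ⊥-elim (x-nonroot x-root₁) ; entry-origin⁻ = λ _ _ q → inj₁ q ; step⁻ = step₁ }
    where open LinkBelow inv inj x-root deg-x x∈G x-fresh Ad y<x deg-y
  append-link {s} {A} {x} {d} {y} {s'} {A''} inv inj x-root deg-x x∈G x-fresh Ad y<x deg-y (air-root y-root₁ inner) = record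
    { forest⁻ = forest′ ; arrayInv⁻ = arrayInv ; occ≡⁻ = λ w → trans (occ≡ w) (linked-occ w) ; nodes≡⁻ = trans nodes≡ linked-nodes
    ; x-occ = subst (1 ≤_) (sym (trans (occ≡ x) (linked-occ x))) x∈G
    ; x-degree = λ x-root′ → ⊥-elim (x-nonroot (StoreStep.roots-reflect step x x-root′))
    ; injective⁻ = λ e e' z q q' z-root _ → injective-restore {s'} {A} {A''} y (degree (s₁ y)) (_≢ d) injective x-entries y-fresh e e' z q q' z-root
    ; below⁻ = λ e e<d → below-unchanged e (subst (e <_) (sym deg-y₁) (≤-trans e<d (n≤1+n d)))
    ; x-entries⁻ = λ x-root′ → ⊥-elim (x-nonroot (StoreStep.roots-reflect step x x-root′))
    ; entry-origin⁻ = origin-nested x y d (degree (s₁ y)) (≤-trans (n≤1+n d) (≤-reflexive (sym deg-y₁))) Ad entry-origin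
    ; step⁻ = StoreStep-trans step₁ step linked-occ kept-≢y }
    where
    open LinkBelow inv inj x-root deg-x x∈G x-fresh Ad y<x deg-y
    y-root : parent (s y) ≡ nothing
    y-root = link-root⁻ s x y x-root x≢y y y-root₁
    y-fresh : ∀ e → e ≢ d → A e ≢ just y
    y-fresh e e≢d Ae = e≢d (inj e d y Ae Ad y-root)
    open AppendResult (append-preserves inner linked inv₁ inj₁′ y-root₁ refl y∈G₁
                         (λ e Ae → subst (e <_) (sym deg-y₁) (s≤s (≤-reflexive (inj e d y Ae Ad y-root)))))

  append-pass inv inj x-root deg-x x∈G x-fresh Ad deg-y (air-skip _) = before-unchanged inv inj deg-x x∈G
  append-pass {s} {A} {x} {d} {y} {s'} {A''} {G} inv inj x-root deg-x x∈G x-fresh Ad deg-y (air-root y-root inner) = record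
    { forest⁻ = forest′ ; arrayInv⁻ = arrayInv ; occ≡⁻ = occ≡ ; nodes≡⁻ = nodes≡
    ; x-occ = subst (1 ≤_) (sym (occ≡ x)) x∈G
    ; x-degree = λ _ → ≤-trans (≤-reflexive (sym deg-x)) (StoreStep.degree-mono step x)
    ; injective⁻ = λ e e' z q q' z-root _ → injective-restore {s'} {A} {A''} y (degree (s y)) (_≢ d) injective x-entries y-fresh e e' z q q' z-root
    ; below⁻ = λ e e<d → below-unchanged e (<-trans e<d d<deg-y)
    ; x-entries⁻ = x-entries′ ; entry-origin⁻ = origin-nested x y d (degree (s y)) (<⇒≤ d<deg-y) Ad entry-origin
    ; step⁻ = StoreStep-trans (StoreStep-refl s G A x) step (λ _ → refl) kept-≢y }
    where
    open AppendCase inv inj x-root deg-x x∈G x-fresh Ad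
    d<deg-y : d < degree (s y)
    d<deg-y = ≤∧≢⇒< (entry-degree d y Ad y-root) (≢-sym deg-y)
    y-fresh : ∀ e → e ≢ d → A e ≢ just y
    y-fresh e e≢d Ae = e≢d (inj e d y Ae Ad y-root)
    open AppendResult (append-preserves inner G inv inj y-root refl y∈G (λ e Ae → subst (_< degree (s y)) (sym (inj e d y Ae Ad y-root)) d<deg-y))
    x-entries′ : parent (s' x) ≡ nothing → ∀ e → A'' e ≡ just x → (e ≡ d) ⊎ (A e ≡ just x)
    x-entries′ _ e q with entry-origin e x q
    ... | inj₁ old = inj₂ old
    ... | inj₂ (inj₁ x≡y) = ⊥-elim (y≢x (sym x≡y))
    ... | inj₂ (inj₂ (e' , deg-y≤e' , Ae')) = ⊥-elim (<-irrefl refl (<-trans (x-fresh e' Ae') (<-≤-trans d<deg-y deg-y≤e')))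

  record AppendAllResult (s : Store) (G : List Tree) (A : Arr) (s' : Store) (A' : Arr) : Set where
    field
      forest″            : List Tree
      arrayInv′          : ArrayInv s' forest″ A'
      injective′         : ArrayInjective s' A'
      occ≡′              : ∀ w → occ w forest″ ≡ occ w G
      nodes≡′            : nodes forest″ ≡ nodes G
      outside-unchanged′ : ∀ w → occ w G ≡ 0 → s' w ≡ s w

  appendAll-preserves : ∀ {s A xs s' A'} → AppendAll s A xs s' A' → ∀ G → ArrayInv s G A → ArrayInjective s A →
    All (λ x → parent (s x) ≡ nothing) xs → All (λ x → ∀ e → A e ≢ just x) xs → Unique xs → All (λ x → 1 ≤ occ x G) xs →
    AppendAllResult s G A s' A'
  appendAll-preserves aa-nil G inv inj _ _ _ _ = record
    { forest″ = G ; arrayInv′ = inv ; injective′ = inj ; occ≡′ = λ _ → refl ; nodes≡′ = refl ; outside-unchanged′ = λ _ _ → refl }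
  appendAll-preserves {A = A} (aa-cons {x = x} {xs = xs} {s₁ = s₁} {A₁ = A₁} ap rest) G inv inj
                      (x-root ∷ roots) (x-fresh ∷ fresh) (x∉xs AllPairs.∷ unique-xs) (x∈G ∷ in-G) = record
    { forest″ = forest″ ; arrayInv′ = arrayInv′ ; injective′ = injective′
    ; occ≡′ = λ w → trans (occ≡′ w) (occ≡ w) ; nodes≡′ = trans nodes≡′ nodes≡
    ; outside-unchanged′ = λ w o → trans (outside-unchanged′ w (trans (occ≡ w) o)) (StoreStep.outside-unchanged step w o) }
    where
    open AppendResult (append-preserves ap G inv inj x-root refl x∈G (λ e Ae → ⊥-elim (x-fresh e Ae)))
    roots₁ : All (λ w → parent (s₁ w) ≡ nothing) xs
    roots₁ = All.zipWith (λ { {w} (w-root , w-fresh , x≢w) → StoreStep.roots-kept step w w-root (≢-sym x≢w) w-fresh })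
               (roots , All.zipWith (λ q → q) (fresh , x∉xs))
    fresh₁ : All (λ w → ∀ e → A₁ e ≢ just w) xs
    fresh₁ = All.zipWith (λ { {w} (w-fresh , x≢w) e q →
               [ w-fresh e , [ (λ w≡x → x≢w (sym w≡x)) , (λ { (e' , _ , Ae') → w-fresh e' Ae' }) ]′ ]′ (entry-origin e w q) })
               (fresh , x∉xs)
    injective₁ : ArrayInjective s₁ A₁
    injective₁ e e' z q q' z-root = injective-restore {s₁} {A} {A₁} x _ (λ _ → ⊤) injective x-entries (λ e _ → x-fresh e) e e' z q q' z-root tt tt
    in-G₁ : All (λ w → 1 ≤ occ w forest′) xs
    in-G₁ = All.map (λ {w} w∈G → subst (1 ≤_) (sym (occ≡ w)) w∈G) in-G
    open AppendAllResult (appendAll-preserves rest forest′ arrayInv injective₁ roots₁ fresh₁ unique-xs in-G₁)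

  record CollectResult (s : Store) (G : List Tree) (R : List Id) (mn : Maybe Id) : Set where
    field
      collected       : List Tree
      collected-roots : R ≡ map label collected
      collected-wf    : WfForest s collected
      collected-occ   : ∀ w → occ w collected ≤ occ w G
      collected-nodes : nodes collected ≤ nodes G
      collected-min   : MinCorrect s collected mn

  -- Facc are the trees collected so far, Grem the trees whose roots are still in A.
  collect-preserves : ∀ s A ds R mn Facc Grem G →
    R ≡ map label Facc → WfForest s Facc → WfForest s Grem →
    (∀ w → occ w Facc + occ w Grem ≤ occ w G) → nodes Facc + nodes Grem ≤ nodes G →
    MinCorrect s Facc mn → AllPairs.AllPairs _≢_ ds →
    (∀ d y → d ∈ ds → A d ≡ just y → parent (s y) ≡ nothing → y ∈ map label Grem) → ArrayInjective s A →
    CollectResult s G (proj₁ (collect s A ds R mn)) (proj₂ (collect s A ds R mn))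
  collect-preserves _ _ [] _ _ Facc _ _ eR wF _ occ≤ nodes≤ minF _ _ _ = record
    { collected = Facc ; collected-roots = eR ; collected-wf = wF
    ; collected-occ = λ w → ≤-trans (m≤m+n _ _) (occ≤ w) ; collected-nodes = ≤-trans (m≤m+n _ _) nodes≤ ; collected-min = minF }
  collect-preserves s A (d ∷ ds) R mn Facc Grem G eR wF wG occ≤ nodes≤ minF (d∉ds AllPairs.∷ distinct) in-Grem inj with A d in Ad
  ... | nothing = collect-preserves s A ds R mn Facc Grem G eR wF wG occ≤ nodes≤ minF distinct (λ d' y q → in-Grem d' y (there q)) inj
  ... | just x with parent (s x) in px
  ...   | just _ = collect-preserves s A ds R mn Facc Grem G eR wF wG occ≤ nodes≤ minF distinct (λ d' y q → in-Grem d' y (there q)) inj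
  ...   | nothing with split-labels x Grem (in-Grem d x (here refl) Ad px)
  ...     | pre , node .x cs , post , refl , refl =
    collect-preserves s A ds (R ++ [ x ]) (newMin s mn x) (Facc ++ [ t ]) (pre ++ post) G
      (trans (cong (_++ [ x ]) eR) (sym (map-++ label Facc [ t ])))
      (WfForest-++ s Facc [ t ] wF (proj₁ wt-mid , proj₁ (proj₂ wt-mid) , tt)) (proj₂ (proj₂ wt-mid))
      (λ w → subst (_≤ occ w G) (sym (weight-move (δ w) Facc pre t post)) (occ≤ w))
      (subst (_≤ nodes G) (sym (weight-move (λ _ → 1) Facc pre t post)) nodes≤)
      (MinCorrect-newMin s (Facc ++ [ t ]) mn x px (occ-++⁺ʳ x Facc [ t ] (1≤+ˡ 0 (occ-label t))) x-min m-or-x)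
      distinct in-Grem′ inj
    where
    t = node x cs
    wt-mid = WfForest-mid s pre t post wG
    old-or-t : ∀ w → 1 ≤ occ w (Facc ++ [ t ]) → (1 ≤ occ w Facc) ⊎ (1 ≤ occT w t)
    old-or-t w p with occ-++⁻ w Facc [ t ] p
    ... | inj₁ q = inj₁ q
    ... | inj₂ q = inj₂ (subst (1 ≤_) (+-identityʳ _) q)
    x-min : mn ≡ nothing → ∀ w → 1 ≤ occ w (Facc ++ [ t ]) → key (s x) ≤ₖ key (s w)
    x-min e w p with old-or-t w p
    ... | inj₁ q = ⊥-elim (occ-[]⁻ (proj₁ minF e) q)
    ... | inj₂ q = heapOrderT-self s x cs w (proj₁ (proj₂ wt-mid)) q
    m-or-x : ∀ m → mn ≡ just m → (parent (s m) ≡ nothing) × (1 ≤ occ m (Facc ++ [ t ])) ×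
               (∀ w → 1 ≤ occ w (Facc ++ [ t ]) → (key (s m) ≤ₖ key (s w)) ⊎ (key (s x) ≤ₖ key (s w)))
    m-or-x m e with proj₂ minF m e
    ... | m-root , mF , m≤ = m-root , occ-++⁺ˡ m Facc [ t ] mF ,
          λ w p → [ (λ q → inj₁ (m≤ w q)) , (λ q → inj₂ (heapOrderT-self s x cs w (proj₁ (proj₂ wt-mid)) q)) ]′ (old-or-t w p)
    in-Grem′ : ∀ d' y → d' ∈ ds → A d' ≡ just y → parent (s y) ≡ nothing → y ∈ map label (pre ++ post)
    in-Grem′ d' y q Ad' py = ∈labels-remove y pre t post (in-Grem d' y (there q) Ad' py)
                               (λ { refl → All.lookup d∉ds q (inj d d' y Ad Ad' py) })

  -- Extracting the minimum

  clearParent : Node → Node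
  clearParent v = record v { parent = nothing }

  clearParents-∉ : ∀ s cs w → ¬ (w ∈ cs) → clearParents s cs w ≡ s w
  clearParents-∉ s [] w w∉ = refl
  clearParents-∉ s (c ∷ cs) w w∉ =
    trans (clearParents-∉ (update s c clearParent) cs w (λ q → w∉ (there q))) (update-≢ s c clearParent w (λ e → w∉ (here e)))

  clearParents-root : ∀ s cs w → parent (s w) ≡ nothing → parent (clearParents s cs w) ≡ nothing
  clearParents-root s [] w w-root = w-root
  clearParents-root s (c ∷ cs) w w-root = clearParents-root (update s c clearParent) cs w (by-cases (w ℕ.≟ c))
    where
    by-cases : Dec (w ≡ c) → parent (update s c clearParent w) ≡ nothing
    by-cases (yes refl) = cong parent (update-≡ s c clearParent)
    by-cases (no w≢c) = trans (cong parent (update-≢ s c clearParent w w≢c)) w-root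

  clearParents-∈ : ∀ s cs w → w ∈ cs → parent (clearParents s cs w) ≡ nothing
  clearParents-∈ s (c ∷ cs) w (here refl) = clearParents-root (update s c clearParent) cs w (cong parent (update-≡ s c clearParent))
  clearParents-∈ s (c ∷ cs) w (there q) = clearParents-∈ (update s c clearParent) cs w q

  clearParents-key : ∀ s cs w → key (clearParents s cs w) ≡ key (s w)
  clearParents-key s [] w = refl
  clearParents-key s (c ∷ cs) w = trans (clearParents-key (update s c clearParent) cs w) (key-update s c clearParent (λ _ → refl) w)

  clearParents-children : ∀ s cs w → children (clearParents s cs w) ≡ children (s w)
  clearParents-children s [] w = refl
  clearParents-children s (c ∷ cs) w = trans (clearParents-children (update s c clearParent) cs w) (children-update w)
    where
    children-update : ∀ w → children (update s c clearParent w) ≡ children (s w)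
    children-update w with w ℕ.≟ c
    ... | yes refl = refl
    ... | no _ = refl

  WfForest-all : ∀ s ts → (∀ t → t ∈ ts → (parent (s (label t)) ≡ nothing) × WfTree s t) → WfForest s ts
  WfForest-all s [] _ = tt
  WfForest-all s (t ∷ ts) h = proj₁ (h t (here refl)) , proj₂ (h t (here refl)) , WfForest-all s ts (λ u q → h u (there q))

  WfForest⇒roots : ∀ s G → WfForest s G → All (λ x → parent (s x) ≡ nothing) (map label G)
  WfForest⇒roots s [] _ = []
  WfForest⇒roots s (t ∷ G) (t-root , _ , wG) = t-root ∷ WfForest⇒roots s G wG

  promote-children : ∀ s pre z us post → WfForest s (pre ++ node z us ∷ post) → OccUnique ((pre ++ post) ++ us) →
    WfForest (clearParents s (children (s z))) ((pre ++ post) ++ us)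
  promote-children s pre z us post wf uq =
    WfForest-++ s₀ (pre ++ post) us
      (WfForest-agree s s₀ (pre ++ post) (proj₂ (proj₂ mid)) (λ w p → clearParents-∉ s cs w (other-not-child w p)))
      (WfForest-all s₀ us promoted)
    where
    cs = children (s z)
    s₀ = clearParents s cs
    mid = WfForest-mid s pre (node z us) post wf
    z-labels : map label us ≡ cs
    z-labels = proj₁ (proj₁ (proj₂ mid))
    uq-split : ∀ w → occ w (pre ++ post) + occ w us ≤ 1
    uq-split w = subst (_≤ 1) (occ-++ w (pre ++ post) us) (uq w)
    other-not-child : ∀ w → 1 ≤ occ w (pre ++ post) → ¬ (w ∈ cs)
    other-not-child w p q = +≤1-exclusive p (∈labels⇒occ w us (subst (w ∈_) (sym z-labels) q)) (uq-split w)
    below-not-child : ∀ c ds w → node c ds ∈ us → 1 ≤ occ w ds → ¬ (w ∈ cs)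
    below-not-child c ds w q p r = +≤1-exclusive (occLabels-∈ w us (subst (w ∈_) (sym z-labels) r)) (occBelow-∈ w c ds us q p)
      (subst (_≤ 1) (occ-split w us) (m+n≤o⇒n≤o (occ w (pre ++ post)) (uq-split w)))
    promoted : ∀ t → t ∈ us → (parent (s₀ (label t)) ≡ nothing) × WfTree s₀ t
    promoted (node c ds) q =
      clearParents-∈ s cs c (subst (c ∈_) z-labels (∈-map⁺ label q)) ,
      WfTree-agree-root s s₀ c ds (WfChildren-∈ s z 0 us (node c ds) q (proj₂ (proj₁ (proj₂ mid))))
        (λ w p → clearParents-∉ s cs w (below-not-child c ds w q p)) (≡⇒≤ₖ (clearParents-key s cs c)) (clearParents-children s cs c)

  removeId-root : ∀ z pre us post → occ z pre ≡ 0 → occ z post ≡ 0 →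
    removeId z (map label (pre ++ node z us ∷ post)) ++ map label us ≡ map label ((pre ++ post) ++ us)
  removeId-root z pre us post z∉pre z∉post = begin
    removeId z (map label (pre ++ node z us ∷ post)) ++ map label us
      ≡⟨ cong (λ R → removeId z R ++ map label us) (map-++ label pre (node z us ∷ post)) ⟩
    removeId z (map label pre ++ z ∷ map label post) ++ map label us ≡⟨ cong (_++ map label us) (removeId-mid z pre post z∉pre z∉post) ⟩
    (map label pre ++ map label post) ++ map label us              ≡⟨ cong (_++ map label us) (sym (map-++ label pre post)) ⟩
    map label (pre ++ post) ++ map label us                        ≡⟨ sym (map-++ label (pre ++ post) us) ⟩
    map label ((pre ++ post) ++ us)                                ∎
    where open ≡-Reasoning

  module _ {W : World} (I : Invariant W) (i : ℕ) where
    open Invariant I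

    extractMin-consolidate : ∀ {z s₁ A₁} → min (heaps W i) ≡ just z →
      AppendAll (clearParents (store W) (children (store W z))) emptyArr (removeId z (roots (heaps W i)) ++ children (store W z)) s₁ A₁ →
      Invariant (mkWorld s₁ (next W) (setHeap (heaps W) i
        (mkHeap (proj₁ (collect s₁ A₁ (upTo (suc (size (heaps W i)))) [] nothing))
                (proj₂ (collect s₁ A₁ (upTo (suc (size (heaps W i)))) [] nothing)) (size (heaps W i) ∸ 1))))
    extractMin-consolidate {z} {s₁} {A₁} z-min appendAll =
      shrinkHeap-preserves I i s₁ _ collected collected-wf collected-roots
        (λ w → ≤-trans (collected-occ w) (≤-trans (≤-reflexive (occ≡′ w)) (G₀≤F w)))
        (≤-trans collected-nodes (≤-trans (≤-reflexive nodes≡′) nodes-G₀)) collected-min agree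
      where
      s = store W
      H = heaps W i
      isMin = proj₂ (minCorrect i) z z-min
      split = root-split s (forest i) z (forest-wf i) (proj₁ (proj₂ isMin)) (proj₁ isMin)
      pre = proj₁ split
      us = proj₁ (proj₂ split)
      post = proj₁ (proj₂ (proj₂ split))
      at : forest i ≡ pre ++ node z us ∷ post
      at = proj₂ (proj₂ (proj₂ split))
      G₀ = (pre ++ post) ++ us
      s₀ = clearParents s (children (s z))
      G₀≤F : ∀ w → occ w G₀ ≤ occ w (forest i)
      G₀≤F w = ≤-trans (m≤n+m _ (δ w z)) (≤-reflexive (sym (trans (cong (occ w) at) (weight-extract (δ w) pre z us post))))
      nodes-G₀ : nodes G₀ ≤ size H ∸ 1
      nodes-G₀ = suc[m]≤n⇒m≤pred[n] (subst (_≤ size H) (trans (cong nodes at) (weight-extract (λ _ → 1) pre z us post)) (nodes≤size i))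
      uniqueG₀ : OccUnique G₀
      uniqueG₀ w = ≤-trans (G₀≤F w) (unique i w)
      wfG₀ : WfForest s₀ G₀
      wfG₀ = promote-children s pre z us post (subst (WfForest s) at (forest-wf i)) uniqueG₀
      z-labels : map label us ≡ children (s z)
      z-labels = proj₁ (proj₁ (proj₂ (WfForest-mid s pre (node z us) post (subst (WfForest s) at (forest-wf i)))))
      z-absent = OccUnique-hole′ (top pre post) z us (subst OccUnique at (unique i))
      roots₀ : removeId z (roots H) ++ children (s z) ≡ map label G₀
      roots₀ = trans (cong₂ _++_ (cong (removeId z) (trans (roots≡labels i) (cong (map label) at))) (sym z-labels))
                 (removeId-root z pre us post (m+n≡0⇒m≡0 _ (proj₁ z-absent)) (m+n≡0⇒n≡0 (occ z pre) (proj₁ z-absent)))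
      arr₀ : ArrayInv s₀ G₀ emptyArr
      arr₀ = record { arr-wf = wfG₀ ; arr-unique = uniqueG₀ ; entry-occ = λ _ _ () ; entry-degree = λ _ _ () }
      consolidated : AppendAllResult s₀ G₀ emptyArr s₁ A₁
      consolidated = appendAll-preserves (subst (λ xs → AppendAll s₀ emptyArr xs s₁ A₁) roots₀ appendAll) G₀ arr₀ (λ _ _ _ ())
        (WfForest⇒roots s₀ G₀ wfG₀) (All.tabulate (λ _ _ ())) (OccUnique⇒Unique G₀ uniqueG₀) (All.tabulate (λ {w} → ∈labels⇒occ w G₀))
      open AppendAllResult consolidated
      open ArrayInv arrayInv′
      collected-forest : CollectResult s₁ forest″ _ _
      collected-forest = collect-preserves s₁ A₁ (upTo (suc (size H))) [] nothing [] forest″ forest″ refl tt arr-wf (λ _ → ≤-refl) ≤-refl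
        ((λ _ → refl) , λ _ ()) (upTo⁺ (suc (size H))) (λ d y _ Ad y-root → root∈labels s₁ forest″ y arr-wf (entry-occ d y Ad) y-root) injective′
      open CollectResult collected-forest
      agree : ∀ w → occ w (forest i) ≡ 0 → s₁ w ≡ s w
      agree w o = trans (outside-unchanged′ w G₀-absent) (clearParents-∉ s (children (s z)) w (λ q → <⇒≱ (in-G₀ q) (≤-reflexive G₀-absent)))
        where
        G₀-absent : occ w G₀ ≡ 0
        G₀-absent = n≤0⇒n≡0 (≤-trans (G₀≤F w) (≤-reflexive o))
        in-G₀ : w ∈ children (s z) → 1 ≤ occ w G₀
        in-G₀ q = occ-++⁺ʳ w (pre ++ post) us (∈labels⇒occ w us (subst (w ∈_) (sym z-labels) q))

    extractMin-preserves : ∀ {s' h'} → ExtractMin (store W) (heaps W i) s' h' → Invariant (mkWorld s' (next W) (setHeap (heaps W) i h'))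
    extractMin-preserves (em-none _) =
      shrinkHeap-preserves I i (store W) (heaps W i) (forest i) (forest-wf i) (roots≡labels i) (λ _ → ≤-refl) (nodes≤size i)
        (minCorrect i) (λ _ _ → refl)
    extractMin-preserves (em-empty {z = z} _ no-roots) =
      shrinkHeap-preserves I i _ _ [] tt refl (λ _ → z≤n) z≤n ((λ _ → refl) , λ _ ()) no-children
      where
      no-children : ∀ w → occ w (forest i) ≡ 0 → clearParents (store W) (children (store W z)) w ≡ store W w
      no-children w _ rewrite ++-conicalʳ (removeId z (roots (heaps W i))) (children (store W z)) no-roots = refl
    extractMin-preserves (em-cons z-min _ (consolidate appendAll)) = extractMin-consolidate z-min appendAll

  invariant : ∀ {W} → Reachable W → Invariant W
  invariant (r-init s) = record
    { forest = λ _ → [] ; forest-wf = λ _ → tt ; roots≡labels = λ _ → refl ; unique = λ _ _ → z≤n ; disjoint = λ _ _ _ ()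
    ; allocated = λ _ _ () ; nodes≤size = λ _ → z≤n ; minCorrect = λ _ → (λ _ → refl) , λ _ () }
  invariant (r-insert r i k) = insert-preserves (invariant r) i k
  invariant (r-union r i≢j) = union-preserves (invariant r) i≢j
  invariant (r-decrease r x∈ k≤x dk) = decreaseKey-preserves (invariant r) x∈ k≤x dk
  invariant (r-extract {i = i} r em) = extractMin-preserves (invariant r) i em

open FibHeap

corollary1 : ∃ λ (c : ℕ) → ∃ λ (n₀ : ℕ) →
    (O : StrictTotalOrder 0ℓ 0ℓ 0ℓ) (W : World O) → Reachable O W →
    (i : ℕ) (x : Id) → InHeap O W i x →
    n₀ ≤ size (heaps W i) →
    degree O (store W x) ≤ c * ⌊log₂ size (heaps W i) ⌋
corollary1 = 3 , 2 , λ O W reachable i x x∈ 2≤n →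
  minSize≤⇒≤3*log (degree O (store W x)) (size (heaps W i)) 2≤n (minSize-degree≤size O (invariant O reachable) i x x∈)
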